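{- Let $P=\langle\mu,\lambda\rangle$ be a finite perfect group with $|\mu|=2$, $|\lambda|=3$. Let $X=P\wr\mathrm{A}_5$, $h_1=(1,1,1,\lambda,\lambda^{ -1})(123)$, $h_2=(\mu,\mu,\mu,1,1)(12)(45)$, $g=(1,\mu,1,1,\mu)(14)(25)$, $H=\langle h_1,h_2\rangle$ and $\Gamma=\mathrm{Cos}(X,H,HgH)$. Then $\Gamma$ is connected, and $X=\langle g,h_1\rangle$; in particular $X$ is a $(2,3)$-generated perfect group.
   Context: $X=P\wr\mathrm{A}_5=P^5{:}\mathrm{A}_5$, where $\mathrm{A}_5=\mathrm{Alt}\{1,\dots,5\}$ (permutations acting on the right) acts on $P^5$ by $(t_1,\dots,t_5)^{\pi^{ -1}}=(t_{1^\pi},\dots,t_{5^\pi})$; elements are written as $(t_1,\dots,t_5)\pi$. The coset graph $\mathrm{Cos}(X,H,HgH)$ has vertex set the right cosets $Hx$ ($x\in X$), with $Hx\sim Hy$ iff $yx^{ -1}\in HgH$. A group is $(2,3)$-generated if it is generated by an element of order $2$ and an element of order $3$; perfect means equal to its commutator subgroup. -}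

module Defs where

open import Level using (Level; _⊔_) renaming (zero to 0ℓ)
open import Data.Nat using (ℕ; _<ᵇ_; _%_)
open import Data.Bool using (Bool; if_then_else_; _∧_)
open import Data.Fin using (Fin; zero; suc; toℕ)
open import Data.List using (List; []; _∷_; map; allFin)
open import Data.Nat.ListAction using (sum)
open import Data.List.Relation.Unary.Any using (Any)
open import Data.Product using (Σ; ∃; ∃-syntax; _×_; _,_)
open import Relation.Nullary using (¬_)
open import Relation.Binary.PropositionalEquality using (_≡_; refl; cong; trans)
open import Algebra.Bundles using (Group)
open import Algebra.Bundles.Raw using (RawGroup)

module GroupNotions {c ℓ : Level} (G : RawGroup c ℓ) where
  open RawGroup G

  data Closure {p : Level} (S : Carrier → Set p) : Carrier → Set (c ⊔ ℓ ⊔ p) where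
    gen  : ∀ {x} → S x → Closure S x
    unit : Closure S ε
    mul  : ∀ {x y} → Closure S x → Closure S y → Closure S (x ∙ y)
    inv  : ∀ {x} → Closure S x → Closure S (x ⁻¹)
    resp : ∀ {x y} → x ≈ y → Closure S x → Closure S y

  ⟨_⟩ : List Carrier → Carrier → Set (c ⊔ ℓ)
  ⟨ gs ⟩ = Closure (λ y → Any (y ≈_) gs)

  Order2 : Carrier → Set ℓ
  Order2 x = (¬ x ≈ ε) × (x ∙ x ≈ ε)

  Order3 : Carrier → Set ℓ
  Order3 x = (¬ x ≈ ε) × ((x ∙ x) ∙ x ≈ ε)

  -- subgroups are given as predicates K on the (ambient) carrier
  Commutator : ∀ {k} (K : Carrier → Set k) → Carrier → Set (c ⊔ ℓ ⊔ k)
  Commutator K x = ∃[ a ] ∃[ b ] K a × K b × (x ≈ (a ⁻¹ ∙ b ⁻¹) ∙ (a ∙ b))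

  Perfect : ∀ {k} (K : Carrier → Set k) → Set (c ⊔ ℓ ⊔ k)
  Perfect K = ∀ x → K x → Closure (Commutator K) x

  GeneratedBy : ∀ {k} (K : Carrier → Set k) → List Carrier → Set (c ⊔ ℓ ⊔ k)
  GeneratedBy K gs = (∀ x → K x → ⟨ gs ⟩ x) × (∀ x → ⟨ gs ⟩ x → K x)

  TwoThreeGenerated : ∀ {k} (K : Carrier → Set k) → Set (c ⊔ ℓ ⊔ k)
  TwoThreeGenerated K =
    ∃[ a ] ∃[ b ] K a × K b × Order2 a × Order3 b × GeneratedBy K (a ∷ b ∷ [])

  -- Coset graph Cos(K, H, HgH): vertices Hx (x ∈ K), Hx ~ Hy iff y x⁻¹ ∈ HgH.
  module CosetGraph {h} (H : Carrier → Set h) (g : Carrier) where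
    Adj : Carrier → Carrier → Set (c ⊔ ℓ ⊔ h)
    Adj x y = ∃[ a ] ∃[ b ] H a × H b × (y ∙ x ⁻¹ ≈ (a ∙ g) ∙ b)

    data Walk : Carrier → Carrier → Set (c ⊔ ℓ ⊔ h) where
      same : ∀ {x y} → H (y ∙ x ⁻¹) → Walk x y
      step : ∀ {x z y} → Walk x z → Adj z y → Walk x y

    Connected : ∀ {k} (K : Carrier → Set k) → Set (c ⊔ ℓ ⊔ h ⊔ k)
    Connected K = ∀ x y → K x → K y → Walk x y

Finite : ∀ {c ℓ} → Group c ℓ → Set (c ⊔ ℓ)
Finite P = ∃[ n ] Σ (Fin n → Carrier) λ f → ∀ x → ∃[ i ] f i ≈ x
  where open Group P

-- Permutations of Fin 5 (acting on the right: i^π = fwd i)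

record Perm5 : Set where
  field
    fwd bwd : Fin 5 → Fin 5
    left    : ∀ i → bwd (fwd i) ≡ i
    right   : ∀ i → fwd (bwd i) ≡ i
open Perm5 public

-- product πσ: first π, then σ
_⨾_ : Perm5 → Perm5 → Perm5
π ⨾ σ = record
  { fwd = λ i → fwd σ (fwd π i)
  ; bwd = λ i → bwd π (bwd σ i)
  ; left = λ i → trans (cong (bwd π) (left σ (fwd π i))) (left π i)
  ; right = λ i → trans (cong (fwd σ) (right π (bwd σ i))) (right σ i)
  }

invP : Perm5 → Perm5
invP π = record { fwd = bwd π ; bwd = fwd π ; left = right π ; right = left π }

idP : Perm5
idP = record { fwd = λ i → i ; bwd = λ i → i ; left = λ _ → refl ; right = λ _ → refl }

inversions : (Fin 5 → Fin 5) → ℕ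
inversions f = sum (map (λ i → sum (map (λ j →
  if (toℕ i <ᵇ toℕ j) ∧ (toℕ (f j) <ᵇ toℕ (f i)) then 1 else 0) (allFin 5))) (allFin 5))

Even : Perm5 → Set
Even π = inversions (fwd π) % 2 ≡ 0

pattern p1 = zero
pattern p2 = suc zero
pattern p3 = suc (suc zero)
pattern p4 = suc (suc (suc zero))
pattern p5 = suc (suc (suc (suc zero)))

c123 c132 : Fin 5 → Fin 5
c123 p1 = p2
c123 p2 = p3
c123 p3 = p1
c123 p4 = p4
c123 p5 = p5
c132 p1 = p3
c132 p2 = p1
c132 p3 = p2
c132 p4 = p4
c132 p5 = p5

cyc123 : Perm5
cyc123 = record { fwd = c123 ; bwd = c132 ; left = l ; right = r }
  where
  l : ∀ i → c132 (c123 i) ≡ i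
  l p1 = refl
  l p2 = refl
  l p3 = refl
  l p4 = refl
  l p5 = refl
  r : ∀ i → c123 (c132 i) ≡ i
  r p1 = refl
  r p2 = refl
  r p3 = refl
  r p4 = refl
  r p5 = refl

s12-45 : Fin 5 → Fin 5
s12-45 p1 = p2
s12-45 p2 = p1
s12-45 p3 = p3
s12-45 p4 = p5
s12-45 p5 = p4

inv12-45 : ∀ i → s12-45 (s12-45 i) ≡ i
inv12-45 p1 = refl
inv12-45 p2 = refl
inv12-45 p3 = refl
inv12-45 p4 = refl
inv12-45 p5 = refl

perm12-45 : Perm5
perm12-45 = record { fwd = s12-45 ; bwd = s12-45 ; left = inv12-45 ; right = inv12-45 }

s14-25 : Fin 5 → Fin 5
s14-25 p1 = p4
s14-25 p2 = p5
s14-25 p3 = p3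
s14-25 p4 = p1
s14-25 p5 = p2

inv14-25 : ∀ i → s14-25 (s14-25 i) ≡ i
inv14-25 p1 = refl
inv14-25 p2 = refl
inv14-25 p3 = refl
inv14-25 p4 = refl
inv14-25 p5 = refl

perm14-25 : Perm5
perm14-25 = record { fwd = s14-25 ; bwd = s14-25 ; left = inv14-25 ; right = inv14-25 }

-- The wreath product P ≀ S5 ⊇ P ≀ A5 = X.
-- Elements (t₁,…,t₅)π; product (t)π · (s)σ = (t · s^{π⁻¹}) πσ with
-- (s^{π⁻¹})_i = s_{i^π}.

module Wreath {c ℓ : Level} (P : Group c ℓ) where
  module P = Group P

  record W : Set c where
    constructor _▹_
    field
      base : Fin 5 → P.Carrier
      top  : Perm5
  open W public

  _≈W_ : W → W → Set ℓ
  (t ▹ π) ≈W (s ▹ σ) = (∀ i → t i P.≈ s i) × (∀ i → fwd π i ≡ fwd σ i)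

  _∙W_ : W → W → W
  (t ▹ π) ∙W (s ▹ σ) = (λ i → t i P.∙ s (fwd π i)) ▹ (π ⨾ σ)

  εW : W
  εW = (λ _ → P.ε) ▹ idP

  _⁻¹W : W → W
  (t ▹ π) ⁻¹W = (λ j → t (bwd π j) P.⁻¹) ▹ invP π

  Wr : RawGroup c ℓ
  Wr = record { Carrier = W ; _≈_ = _≈W_ ; _∙_ = _∙W_ ; ε = εW ; _⁻¹ = _⁻¹W }

  InX : W → Set
  InX x = Even (top x)

  -- the specific elements of the theorem (positions 1..5 ↦ p1..p5)
  module Elements (μ la : P.Carrier) where
    h₁ h₂ g : W
    h₁ = (λ { p4 → la ; p5 → la P.⁻¹ ; _ → P.ε }) ▹ cyc123
    h₂ = (λ { p1 → μ ; p2 → μ ; p3 → μ ; _ → P.ε }) ▹ perm12-45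
    g  = (λ { p2 → μ ; p5 → μ ; _ → P.ε }) ▹ perm14-25

-- Let G = ⟨ g , h₁ ⟩ ≤ P ≀ S₅. The tops of g and h₁ generate A₅, so X = G amounts to P⁵ ≤ G.
-- The first coordinates of the elements of G fixing the points 1 and 2 form a subgroup of P containing
-- λ and μλμ, hence all of P, since P is perfect and P/⟨⟨ λ ⟩⟩ is cyclic. Conjugating by such elements
-- shows that the first coordinates of the elements of G ∩ P⁵ with trivial second coordinate form a
-- normal subgroup N of P; a word in g and h₁ puts (λμ)⁶ into N, so P/N is a perfect quotient of the
-- solvable triangle group Δ(2,3,6), and N = P. Moving coordinates around with elements of G and taking
-- commutators (P is perfect again) yields every element of P⁵ supported on a single coordinate, hence
-- P⁵ ≤ G. X is perfect because P and A₅ are. Finally, since h₁ ∈ H and g = g⁻¹ ∈ HgH, the vertex H h₁ x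
-- equals Hx and H g x is adjacent to it; so Hzx is reachable from Hx for every z ∈ ⟨ g , h₁ ⟩ = X.

module Submission where

open import Level using (Level; _⊔_)
open import Data.Nat using (ℕ; zero; suc; _%_; _<ᵇ_)
open import Data.Nat.ListAction using (sum)
open import Data.Nat.Properties using () renaming (_≟_ to _≟ℕ_)
open import Data.Fin using (Fin; zero; suc; toℕ) renaming (_≟_ to _≟ᶠ_)
open import Data.Fin.Properties using () renaming (all? to ∀-fin?)
open import Data.Bool using (Bool; true; false; not; _∧_; if_then_else_)
open import Data.Bool.Properties using () renaming (_≟_ to _≟ᵇ_)
open import Data.List using (List; []; _∷_; _++_; foldr; allFin)
open import Data.List.Properties using (map-cong)
open import Data.List.Relation.Unary.Any as Any using (Any; here; there; any?)
open import Data.List.Relation.Unary.All as All using (All; []; _∷_; all?)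
open import Data.Product using (Σ; ∃; _×_; _,_; proj₁; proj₂)
open import Data.Sum using (_⊎_; inj₁; inj₂)
open import Data.Empty using (⊥-elim)
open import Data.Unit using (⊤; tt)
open import Data.Vec using (Vec; lookup) renaming (_∷_ to _∷ᵛ_; [] to []ᵛ)
open import Relation.Nullary using (Dec; ¬_; yes; no; does)
open import Relation.Nullary.Decidable using (from-yes; _→-dec_)
open import Relation.Unary using (_∪_)
open import Relation.Binary.PropositionalEquality as ≡ using (_≡_; _≗_)
open import Algebra.Bundles using (Group)
import Algebra.Properties.Group as GroupProperties
import Relation.Binary.Reasoning.Setoid as SetoidReasoning
open import Defs

-- Normalisation of group words

module GroupWords {c ℓ : Level} (G : Group c ℓ) where
  open Group G
  open GroupProperties G using (⁻¹-involutive; ⁻¹-anti-homo-∙; ε⁻¹≈ε)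
  open SetoidReasoning setoid

  infixl 6 _∙′_
  infix 7 _⁻¹′

  data Expr (n : ℕ) : Set where
    var   : Fin n → Expr n
    ε′    : Expr n
    _∙′_  : Expr n → Expr n → Expr n
    _⁻¹′  : Expr n → Expr n

  x₀ : ∀ {n} → Expr (suc n)
  x₀ = var zero
  x₁ : ∀ {n} → Expr (suc (suc n))
  x₁ = var (suc zero)
  x₂ : ∀ {n} → Expr (suc (suc (suc n)))
  x₂ = var (suc (suc zero))
  x₃ : ∀ {n} → Expr (suc (suc (suc (suc n))))
  x₃ = var (suc (suc (suc zero)))
  x₄ : ∀ {n} → Expr (suc (suc (suc (suc (suc n)))))
  x₄ = var (suc (suc (suc (suc zero))))

  -- A literal is a variable (true) or its inverse (false); normal forms are reduced lists of literals.
  Literal : ℕ → Set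
  Literal n = Fin n × Bool

  module _ {n : ℕ} (ρ : Vec Carrier n) where
    ⟦_⟧ : Expr n → Carrier
    ⟦ var i ⟧  = lookup ρ i
    ⟦ ε′ ⟧     = ε
    ⟦ a ∙′ b ⟧ = ⟦ a ⟧ ∙ ⟦ b ⟧
    ⟦ a ⁻¹′ ⟧  = ⟦ a ⟧ ⁻¹

    ⟦_⟧ˡ : Literal n → Carrier
    ⟦ i , true ⟧ˡ  = lookup ρ i
    ⟦ i , false ⟧ˡ = lookup ρ i ⁻¹

    ⟦_⟧ʷ : List (Literal n) → Carrier
    ⟦ [] ⟧ʷ    = ε
    ⟦ x ∷ w ⟧ʷ = ⟦ x ⟧ˡ ∙ ⟦ w ⟧ʷ

  inverse? : ∀ {n} → Literal n → Literal n → Bool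
  inverse? (i , s) (j , t) = does (i ≟ᶠ j) ∧ not (does (s ≟ᵇ t))

  cons : ∀ {n} → Literal n → List (Literal n) → List (Literal n)
  cons x []      = x ∷ []
  cons x (y ∷ w) = if inverse? x y then w else x ∷ y ∷ w

  append : ∀ {n} → List (Literal n) → List (Literal n) → List (Literal n)
  append []      w = w
  append (x ∷ u) w = cons x (append u w)

  invert : ∀ {n} → List (Literal n) → List (Literal n)
  invert []            = []
  invert ((i , s) ∷ w) = append (invert w) ((i , not s) ∷ [])

  normalise : ∀ {n} → Expr n → List (Literal n)
  normalise (var i)  = (i , true) ∷ []
  normalise ε′       = []
  normalise (a ∙′ b) = append (normalise a) (normalise b)
  normalise (a ⁻¹′)  = invert (normalise a)

  module _ {n : ℕ} (ρ : Vec Carrier n) where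
    private
      ⟦_⟧ʷρ : List (Literal n) → Carrier
      ⟦_⟧ʷρ = ⟦_⟧ʷ ρ
      ⟦_⟧ˡρ : Literal n → Carrier
      ⟦_⟧ˡρ = ⟦_⟧ˡ ρ

    inverse?-sound : ∀ x y → inverse? x y ≡ true → ⟦ x ⟧ˡρ ∙ ⟦ y ⟧ˡρ ≈ ε
    inverse?-sound (i , s) (j , t) eq with i ≟ᶠ j
    inverse?-sound (i , true)  (.i , false) eq | yes ≡.refl = inverseʳ (lookup ρ i)
    inverse?-sound (i , false) (.i , true)  eq | yes ≡.refl = inverseˡ (lookup ρ i)
    inverse?-sound (i , true)  (.i , true)  () | yes ≡.refl
    inverse?-sound (i , false) (.i , false) () | yes ≡.refl
    inverse?-sound (i , s)     (j , t)      () | no _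

    cons-sound : ∀ x w → ⟦ cons x w ⟧ʷρ ≈ ⟦ x ⟧ˡρ ∙ ⟦ w ⟧ʷρ
    cons-sound x []      = refl
    cons-sound x (y ∷ w) with inverse? x y in eq
    ... | false = refl
    ... | true  = begin
      ⟦ w ⟧ʷρ                          ≈⟨ identityˡ _ ⟨
      ε ∙ ⟦ w ⟧ʷρ                      ≈⟨ ∙-congʳ (inverse?-sound x y eq) ⟨
      (⟦ x ⟧ˡρ ∙ ⟦ y ⟧ˡρ) ∙ ⟦ w ⟧ʷρ    ≈⟨ assoc _ _ _ ⟩
      ⟦ x ⟧ˡρ ∙ (⟦ y ⟧ˡρ ∙ ⟦ w ⟧ʷρ)    ∎

    append-sound : ∀ u w → ⟦ append u w ⟧ʷρ ≈ ⟦ u ⟧ʷρ ∙ ⟦ w ⟧ʷρ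
    append-sound []      w = sym (identityˡ _)
    append-sound (x ∷ u) w = begin
      ⟦ cons x (append u w) ⟧ʷρ      ≈⟨ cons-sound x (append u w) ⟩
      ⟦ x ⟧ˡρ ∙ ⟦ append u w ⟧ʷρ     ≈⟨ ∙-congˡ (append-sound u w) ⟩
      ⟦ x ⟧ˡρ ∙ (⟦ u ⟧ʷρ ∙ ⟦ w ⟧ʷρ)  ≈⟨ assoc _ _ _ ⟨
      ⟦ x ∷ u ⟧ʷρ ∙ ⟦ w ⟧ʷρ          ∎

    invert-sound : ∀ w → ⟦ invert w ⟧ʷρ ≈ ⟦ w ⟧ʷρ ⁻¹
    invert-sound [] = sym ε⁻¹≈ε
    invert-sound ((i , s) ∷ w) = begin
      ⟦ append (invert w) ((i , not s) ∷ []) ⟧ʷρ   ≈⟨ append-sound (invert w) _ ⟩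
      ⟦ invert w ⟧ʷρ ∙ (⟦ i , not s ⟧ˡρ ∙ ε)       ≈⟨ ∙-cong (invert-sound w) (identityʳ _) ⟩
      ⟦ w ⟧ʷρ ⁻¹ ∙ ⟦ i , not s ⟧ˡρ                  ≈⟨ ∙-congˡ (flip s) ⟩
      ⟦ w ⟧ʷρ ⁻¹ ∙ ⟦ i , s ⟧ˡρ ⁻¹                   ≈⟨ ⁻¹-anti-homo-∙ _ _ ⟨
      ⟦ (i , s) ∷ w ⟧ʷρ ⁻¹                          ∎
      where
      flip : ∀ s → ⟦ i , not s ⟧ˡρ ≈ ⟦ i , s ⟧ˡρ ⁻¹
      flip true  = refl
      flip false = sym (⁻¹-involutive _)

    normalise-sound : ∀ a → ⟦ ρ ⟧ a ≈ ⟦ normalise a ⟧ʷρ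
    normalise-sound (var i)  = sym (identityʳ _)
    normalise-sound ε′       = refl
    normalise-sound (a ∙′ b) = trans (∙-cong (normalise-sound a) (normalise-sound b))
                                     (sym (append-sound (normalise a) (normalise b)))
    normalise-sound (a ⁻¹′)  = trans (⁻¹-cong (normalise-sound a)) (sym (invert-sound (normalise a)))

    solve : ∀ a b → normalise a ≡ normalise b → ⟦ ρ ⟧ a ≈ ⟦ ρ ⟧ b
    solve a b eq = begin
      ⟦ ρ ⟧ a                 ≈⟨ normalise-sound a ⟩
      ⟦ normalise a ⟧ʷρ       ≡⟨ ≡.cong ⟦_⟧ʷρ eq ⟩
      ⟦ normalise b ⟧ʷρ       ≈⟨ normalise-sound b ⟨
      ⟦ ρ ⟧ b                 ∎

module Subgroups {c ℓ : Level} (G : Group c ℓ) where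
  open Group G
  open GroupProperties G using (ε⁻¹≈ε)
  open GroupWords G using (solve; x₀; x₁; x₂; x₃; ε′; _∙′_; _⁻¹′)
  open GroupNotions rawGroup public using (Closure; gen; unit; mul; inv; resp; ⟨_⟩; Commutator)
  open SetoidReasoning setoid

  IsPerfect : Set (c ⊔ ℓ)
  IsPerfect = GroupNotions.Perfect rawGroup (λ _ → ⊤)

  record IsSubgroup {k : Level} (S : Carrier → Set k) : Set (c ⊔ ℓ ⊔ k) where
    field
      ε∈       : S ε
      ∙-closed : ∀ {x y} → S x → S y → S (x ∙ y)
      ⁻¹-closed : ∀ {x} → S x → S (x ⁻¹)
      ∈-resp-≈ : ∀ {x y} → x ≈ y → S x → S y

  closure-isSubgroup : ∀ {p} (T : Carrier → Set p) → IsSubgroup (Closure T)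
  closure-isSubgroup T = record { ε∈ = unit ; ∙-closed = mul ; ⁻¹-closed = inv ; ∈-resp-≈ = resp }

  closure-least : ∀ {p k} {T : Carrier → Set p} {S : Carrier → Set k} →
                  IsSubgroup S → (∀ {x} → T x → S x) → ∀ {x} → Closure T x → S x
  closure-least S-sub T⊆S (gen t)    = T⊆S t
  closure-least S-sub T⊆S unit       = IsSubgroup.ε∈ S-sub
  closure-least S-sub T⊆S (mul a b)  = IsSubgroup.∙-closed S-sub (closure-least S-sub T⊆S a) (closure-least S-sub T⊆S b)
  closure-least S-sub T⊆S (inv a)    = IsSubgroup.⁻¹-closed S-sub (closure-least S-sub T⊆S a)
  closure-least S-sub T⊆S (resp q a) = IsSubgroup.∈-resp-≈ S-sub q (closure-least S-sub T⊆S a)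

  [_,_] : Carrier → Carrier → Carrier
  [ a , b ] = (a ⁻¹ ∙ b ⁻¹) ∙ (a ∙ b)

  [,]-cong : ∀ {a a′ b b′} → a ≈ a′ → b ≈ b′ → [ a , b ] ≈ [ a′ , b′ ]
  [,]-cong p q = ∙-cong (∙-cong (⁻¹-cong p) (⁻¹-cong q)) (∙-cong p q)

  [,]-anticomm : ∀ a b → [ b , a ] ≈ [ a , b ] ⁻¹
  [,]-anticomm a b =
    solve (a ∷ᵛ b ∷ᵛ []ᵛ) ((x₁ ⁻¹′ ∙′ x₀ ⁻¹′) ∙′ (x₁ ∙′ x₀)) (((x₀ ⁻¹′ ∙′ x₁ ⁻¹′) ∙′ (x₀ ∙′ x₁)) ⁻¹′) ≡.refl

  Commute : Carrier → Carrier → Set ℓ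
  Commute a b = a ∙ b ≈ b ∙ a

  commute⇒[,]≈ε : ∀ {a b} → Commute a b → [ a , b ] ≈ ε
  commute⇒[,]≈ε {a} {b} ab≈ba = begin
    (a ⁻¹ ∙ b ⁻¹) ∙ (a ∙ b)   ≈⟨ ∙-congˡ ab≈ba ⟩
    (a ⁻¹ ∙ b ⁻¹) ∙ (b ∙ a)   ≈⟨ solve (a ∷ᵛ b ∷ᵛ []ᵛ) ((x₀ ⁻¹′ ∙′ x₁ ⁻¹′) ∙′ (x₁ ∙′ x₀)) ε′ ≡.refl ⟩
    ε                         ∎

  [,]≈ε⇒commute : ∀ {a b} → [ a , b ] ≈ ε → Commute a b
  [,]≈ε⇒commute {a} {b} [a,b]≈ε = begin
    a ∙ b                 ≈⟨ solve (a ∷ᵛ b ∷ᵛ []ᵛ) (x₀ ∙′ x₁) ((x₁ ∙′ x₀) ∙′ ((x₀ ⁻¹′ ∙′ x₁ ⁻¹′) ∙′ (x₀ ∙′ x₁))) ≡.refl ⟩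
    (b ∙ a) ∙ [ a , b ]   ≈⟨ ∙-congˡ [a,b]≈ε ⟩
    (b ∙ a) ∙ ε           ≈⟨ identityʳ _ ⟩
    b ∙ a                 ∎

  [,]-self : ∀ a → [ a , a ] ≈ ε
  [,]-self a = commute⇒[,]≈ε refl

  [,]-trivialˡ : ∀ {a b} → a ≈ ε → [ a , b ] ≈ ε
  [,]-trivialˡ {a} {b} a≈ε = trans ([,]-cong a≈ε refl) (commute⇒[,]≈ε (trans (identityˡ b) (sym (identityʳ b))))

  [,]-trivialʳ : ∀ {a b} → b ≈ ε → [ a , b ] ≈ ε
  [,]-trivialʳ {a} {b} b≈ε = trans ([,]-cong refl b≈ε) (commute⇒[,]≈ε (trans (identityʳ a) (sym (identityˡ a))))

  centraliser-isSubgroup : ∀ a → IsSubgroup (Commute a)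
  centraliser-isSubgroup a = record
    { ε∈       = trans (identityʳ a) (sym (identityˡ a))
    ; ∙-closed = λ {x} {y} ax≈xa ay≈ya → begin
        a ∙ (x ∙ y)   ≈⟨ assoc _ _ _ ⟨
        (a ∙ x) ∙ y   ≈⟨ ∙-congʳ ax≈xa ⟩
        (x ∙ a) ∙ y   ≈⟨ assoc _ _ _ ⟩
        x ∙ (a ∙ y)   ≈⟨ ∙-congˡ ay≈ya ⟩
        x ∙ (y ∙ a)   ≈⟨ assoc _ _ _ ⟨
        (x ∙ y) ∙ a   ∎
    ; ⁻¹-closed = λ {x} ax≈xa → begin
        a ∙ x ⁻¹                    ≈⟨ solve (a ∷ᵛ x ∷ᵛ []ᵛ) (x₀ ∙′ x₁ ⁻¹′) (x₁ ⁻¹′ ∙′ ((x₁ ∙′ x₀) ∙′ x₁ ⁻¹′)) ≡.refl ⟩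
        x ⁻¹ ∙ ((x ∙ a) ∙ x ⁻¹)     ≈⟨ ∙-congˡ (∙-congʳ ax≈xa) ⟨
        x ⁻¹ ∙ ((a ∙ x) ∙ x ⁻¹)     ≈⟨ solve (a ∷ᵛ x ∷ᵛ []ᵛ) (x₁ ⁻¹′ ∙′ ((x₀ ∙′ x₁) ∙′ x₁ ⁻¹′)) (x₁ ⁻¹′ ∙′ x₀) ≡.refl ⟩
        x ⁻¹ ∙ a                    ∎
    ; ∈-resp-≈ = λ x≈y ax≈xa → trans (∙-congˡ (sym x≈y)) (trans ax≈xa (∙-congʳ x≈y))
    }

  closure-commute : ∀ {p} {T : Carrier → Set p} → (∀ {s t} → T s → T t → Commute s t) →
                    ∀ {x y} → Closure T x → Closure T y → Commute x y
  closure-commute {T = T} T-commute {x} {y} x∈ y∈ =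
    closure-least commutesWithY (λ s∈ → closure-least (centraliser-isSubgroup _) (T-commute s∈) y∈) x∈
    where
    commutesWithY : IsSubgroup (λ x → Commute x y)
    commutesWithY = record
      { ε∈        = sym ε∈
      ; ∙-closed  = λ p q → sym (∙-closed (sym p) (sym q))
      ; ⁻¹-closed = λ p → sym (⁻¹-closed (sym p))
      ; ∈-resp-≈  = λ e p → sym (∈-resp-≈ e (sym p))
      }
      where open IsSubgroup (centraliser-isSubgroup y)

  infixl 8 _^_
  _^_ : Carrier → Carrier → Carrier
  x ^ g = (g ⁻¹ ∙ x) ∙ g

  ^-cong : ∀ {x x′ g g′} → x ≈ x′ → g ≈ g′ → x ^ g ≈ x′ ^ g′
  ^-cong x≈x′ g≈g′ = ∙-cong (∙-cong (⁻¹-cong g≈g′) x≈x′) g≈g′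

  ε^ : ∀ g → ε ^ g ≈ ε
  ε^ g = solve (g ∷ᵛ []ᵛ) ((x₀ ⁻¹′ ∙′ ε′) ∙′ x₀) ε′ ≡.refl

  IsNormal : ∀ {k} → (Carrier → Set k) → Set (c ⊔ k)
  IsNormal N = ∀ g {x} → N x → N (x ^ g)

  -- Conjugation by s⁻¹ must be checked as well, since the generators S are also inverted.
  closure-isNormal : ∀ {p q} {T : Carrier → Set p} {S : Carrier → Set q} →
    (∀ {s t} → S s → T t → Closure T (t ^ s) × Closure T ((s ∙ t) ∙ s ⁻¹)) →
    (∀ g → Closure S g) → IsNormal (Closure T)
  closure-isNormal {p} {T = T} {S = S} conj-gen S-generates g x∈ =
    proj₁ (closure-least normalisers-isSubgroup normalises (S-generates g) x∈)
    where
    Normalises : Carrier → Set (c ⊔ ℓ ⊔ p)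
    Normalises s = ∀ {x} → Closure T x → Closure T (x ^ s) × Closure T ((s ∙ x) ∙ s ⁻¹)

    normalisers-isSubgroup : IsSubgroup Normalises
    normalisers-isSubgroup = record
      { ε∈ = λ {x} x∈ →
            resp (solve (x ∷ᵛ []ᵛ) x₀ ((ε′ ⁻¹′ ∙′ x₀) ∙′ ε′) ≡.refl) x∈
          , resp (solve (x ∷ᵛ []ᵛ) x₀ ((ε′ ∙′ x₀) ∙′ ε′ ⁻¹′) ≡.refl) x∈
      ; ∙-closed = λ {a} {b} na nb {x} x∈ →
            resp (solve (a ∷ᵛ b ∷ᵛ x ∷ᵛ []ᵛ) ((x₁ ⁻¹′ ∙′ ((x₀ ⁻¹′ ∙′ x₂) ∙′ x₀)) ∙′ x₁)
                                             (((x₀ ∙′ x₁) ⁻¹′ ∙′ x₂) ∙′ (x₀ ∙′ x₁)) ≡.refl)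
                 (proj₁ (nb (proj₁ (na x∈))))
          , resp (solve (a ∷ᵛ b ∷ᵛ x ∷ᵛ []ᵛ) ((x₀ ∙′ ((x₁ ∙′ x₂) ∙′ x₁ ⁻¹′)) ∙′ x₀ ⁻¹′)
                                             (((x₀ ∙′ x₁) ∙′ x₂) ∙′ (x₀ ∙′ x₁) ⁻¹′) ≡.refl)
                 (proj₂ (na (proj₂ (nb x∈))))
      ; ⁻¹-closed = λ {a} na {x} x∈ →
            resp (solve (a ∷ᵛ x ∷ᵛ []ᵛ) ((x₀ ∙′ x₁) ∙′ x₀ ⁻¹′) ((x₀ ⁻¹′ ⁻¹′ ∙′ x₁) ∙′ x₀ ⁻¹′) ≡.refl) (proj₂ (na x∈))
          , resp (solve (a ∷ᵛ x ∷ᵛ []ᵛ) ((x₀ ⁻¹′ ∙′ x₁) ∙′ x₀) ((x₀ ⁻¹′ ∙′ x₁) ∙′ x₀ ⁻¹′ ⁻¹′) ≡.refl) (proj₁ (na x∈))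
      ; ∈-resp-≈ = λ a≈b na x∈ →
            resp (∙-cong (∙-congʳ (⁻¹-cong a≈b)) a≈b) (proj₁ (na x∈))
          , resp (∙-cong (∙-congʳ a≈b) (⁻¹-cong a≈b)) (proj₂ (na x∈))
      }

    normalises : ∀ {s} → S s → Normalises s
    normalises {s} s∈ = closure-least conjugates-isSubgroup (conj-gen s∈)
      where
      conjugates-isSubgroup : IsSubgroup (λ x → Closure T (x ^ s) × Closure T ((s ∙ x) ∙ s ⁻¹))
      conjugates-isSubgroup = record
        { ε∈ = resp (solve (s ∷ᵛ []ᵛ) ε′ ((x₀ ⁻¹′ ∙′ ε′) ∙′ x₀) ≡.refl) unit
             , resp (solve (s ∷ᵛ []ᵛ) ε′ ((x₀ ∙′ ε′) ∙′ x₀ ⁻¹′) ≡.refl) unit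
        ; ∙-closed = λ {x} {y} p q →
              resp (solve (s ∷ᵛ x ∷ᵛ y ∷ᵛ []ᵛ) (((x₀ ⁻¹′ ∙′ x₁) ∙′ x₀) ∙′ ((x₀ ⁻¹′ ∙′ x₂) ∙′ x₀))
                                               ((x₀ ⁻¹′ ∙′ (x₁ ∙′ x₂)) ∙′ x₀) ≡.refl)
                   (mul (proj₁ p) (proj₁ q))
            , resp (solve (s ∷ᵛ x ∷ᵛ y ∷ᵛ []ᵛ) (((x₀ ∙′ x₁) ∙′ x₀ ⁻¹′) ∙′ ((x₀ ∙′ x₂) ∙′ x₀ ⁻¹′))
                                               ((x₀ ∙′ (x₁ ∙′ x₂)) ∙′ x₀ ⁻¹′) ≡.refl)
                   (mul (proj₂ p) (proj₂ q))
        ; ⁻¹-closed = λ {x} p →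
              resp (solve (s ∷ᵛ x ∷ᵛ []ᵛ) (((x₀ ⁻¹′ ∙′ x₁) ∙′ x₀) ⁻¹′) ((x₀ ⁻¹′ ∙′ x₁ ⁻¹′) ∙′ x₀) ≡.refl) (inv (proj₁ p))
            , resp (solve (s ∷ᵛ x ∷ᵛ []ᵛ) (((x₀ ∙′ x₁) ∙′ x₀ ⁻¹′) ⁻¹′) ((x₀ ∙′ x₁ ⁻¹′) ∙′ x₀ ⁻¹′) ≡.refl) (inv (proj₂ p))
        ; ∈-resp-≈ = λ x≈y p → resp (∙-congʳ (∙-congˡ x≈y)) (proj₁ p) , resp (∙-congʳ (∙-congˡ x≈y)) (proj₂ p)
        }

  generators-pairwise : ∀ {p} {R : Carrier → Carrier → Set p} →
    (∀ {s s′ t t′} → s ≈ s′ → t ≈ t′ → R s′ t′ → R s t) →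
    ∀ {gs hs} → All (λ s → All (R s) hs) gs → ∀ {s t} → Any (s ≈_) gs → Any (t ≈_) hs → R s t
  generators-pairwise {R = R} R-resp (row ∷ _) {s} (here {x = s′} s≈s′) t∈ = lookupRow row t∈
    where
    lookupRow : ∀ {t hs} → All (R s′) hs → Any (t ≈_) hs → R s t
    lookupRow (r ∷ _)  (here t≈t′) = R-resp s≈s′ t≈t′ r
    lookupRow (_ ∷ rs) (there t∈)  = lookupRow rs t∈
  generators-pairwise R-resp (_ ∷ rows) (there s∈) t∈ = generators-pairwise R-resp rows s∈ t∈

  ⟨⟩-isNormal : ∀ {gs hs} → All (λ s → All (λ t → ⟨ hs ⟩ (t ^ s) × ⟨ hs ⟩ ((s ∙ t) ∙ s ⁻¹)) hs) gs →
                (∀ g → ⟨ gs ⟩ g) → IsNormal ⟨ hs ⟩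
  ⟨⟩-isNormal table = closure-isNormal (generators-pairwise
    (λ s≈ t≈ (p , q) → resp (sym (^-cong t≈ s≈)) p , resp (sym (∙-cong (∙-cong s≈ t≈) (⁻¹-cong s≈))) q)
    table)

  perfect-⊆ : IsPerfect → ∀ {k} {S : Carrier → Set k} → IsSubgroup S → (∀ a b → S [ a , b ]) → ∀ x → S x
  perfect-⊆ perfect S-sub S∋[,] x =
    closure-least S-sub (λ { (a , b , _ , _ , x≈[a,b]) → IsSubgroup.∈-resp-≈ S-sub (sym x≈[a,b]) (S∋[,] a b) })
                  (perfect x tt)

  trivial-isSubgroup : IsSubgroup (_≈ ε)
  trivial-isSubgroup = record
    { ε∈        = refl
    ; ∙-closed  = λ x≈ε y≈ε → trans (∙-cong x≈ε y≈ε) (identityʳ ε)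
    ; ⁻¹-closed = λ x≈ε → trans (⁻¹-cong x≈ε) ε⁻¹≈ε
    ; ∈-resp-≈  = λ x≈y x≈ε → trans (sym x≈y) x≈ε
    }

  abelian-perfect⇒trivial : IsPerfect → (∀ x y → Commute x y) → ∀ x → x ≈ ε
  abelian-perfect⇒trivial perfect commute =
    perfect-⊆ perfect trivial-isSubgroup (λ a b → commute⇒[,]≈ε (commute a b))

  -- The quotient G/N, modelled on the same carrier with x ≈ y mod N iff x y⁻¹ ∈ N.
  module Quotient {k : Level} (N : Carrier → Set k) (N-sub : IsSubgroup N) (N-normal : IsNormal N) where
    open IsSubgroup N-sub

    infix 4 _≈ₙ_
    _≈ₙ_ : Carrier → Carrier → Set k
    x ≈ₙ y = N (x ∙ y ⁻¹)

    ≈⇒≈ₙ : ∀ {x y} → x ≈ y → x ≈ₙ y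
    ≈⇒≈ₙ {x} {y} x≈y = ∈-resp-≈ (trans (sym (inverseʳ y)) (∙-congʳ (sym x≈y))) ε∈

    ≈ₙ-sym : ∀ {x y} → x ≈ₙ y → y ≈ₙ x
    ≈ₙ-sym {x} {y} p = ∈-resp-≈ (solve (x ∷ᵛ y ∷ᵛ []ᵛ) ((x₀ ∙′ x₁ ⁻¹′) ⁻¹′) (x₁ ∙′ x₀ ⁻¹′) ≡.refl) (⁻¹-closed p)

    ≈ₙ-trans : ∀ {x y z} → x ≈ₙ y → y ≈ₙ z → x ≈ₙ z
    ≈ₙ-trans {x} {y} {z} p q =
      ∈-resp-≈ (solve (x ∷ᵛ y ∷ᵛ z ∷ᵛ []ᵛ) ((x₀ ∙′ x₁ ⁻¹′) ∙′ (x₁ ∙′ x₂ ⁻¹′)) (x₀ ∙′ x₂ ⁻¹′) ≡.refl) (∙-closed p q)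

    ∙-congₙ : ∀ {x x′ y y′} → x ≈ₙ x′ → y ≈ₙ y′ → x ∙ y ≈ₙ x′ ∙ y′
    ∙-congₙ {x} {x′} {y} {y′} p q = ∈-resp-≈
      (solve (x ∷ᵛ x′ ∷ᵛ y ∷ᵛ y′ ∷ᵛ []ᵛ) (((x₀ ⁻¹′ ⁻¹′ ∙′ (x₂ ∙′ x₃ ⁻¹′)) ∙′ x₀ ⁻¹′) ∙′ (x₀ ∙′ x₁ ⁻¹′))
                                         ((x₀ ∙′ x₂) ∙′ (x₁ ∙′ x₃) ⁻¹′) ≡.refl)
      (∙-closed (N-normal (x ⁻¹) q) p)

    ⁻¹-congₙ : ∀ {x y} → x ≈ₙ y → x ⁻¹ ≈ₙ y ⁻¹
    ⁻¹-congₙ {x} {y} p = ∈-resp-≈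
      (solve (x ∷ᵛ y ∷ᵛ []ᵛ) ((x₀ ⁻¹′ ∙′ (x₁ ∙′ x₀ ⁻¹′)) ∙′ x₀) (x₀ ⁻¹′ ∙′ x₁ ⁻¹′ ⁻¹′) ≡.refl)
      (N-normal x (≈ₙ-sym p))

    quotient : Group c k
    quotient = record
      { Carrier = Carrier ; _≈_ = _≈ₙ_ ; _∙_ = _∙_ ; ε = ε ; _⁻¹ = _⁻¹
      ; isGroup = record
        { isMonoid = record
          { isSemigroup = record
            { isMagma = record
              { isEquivalence = record { refl = ≈⇒≈ₙ refl ; sym = ≈ₙ-sym ; trans = ≈ₙ-trans }
              ; ∙-cong = ∙-congₙ }
            ; assoc = λ x y z → ≈⇒≈ₙ (assoc x y z) }
          ; identity = (λ x → ≈⇒≈ₙ (identityˡ x)) , (λ x → ≈⇒≈ₙ (identityʳ x)) }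
        ; inverse = (λ x → ≈⇒≈ₙ (inverseˡ x)) , (λ x → ≈⇒≈ₙ (inverseʳ x))
        ; ⁻¹-cong = ⁻¹-congₙ } }

    ∈⇒≈ₙε : ∀ {x} → N x → x ≈ₙ ε
    ∈⇒≈ₙε = ∈-resp-≈ (sym (trans (∙-congˡ ε⁻¹≈ε) (identityʳ _)))

    ≈ₙε⇒∈ : ∀ {x} → x ≈ₙ ε → N x
    ≈ₙε⇒∈ = ∈-resp-≈ (trans (∙-congˡ ε⁻¹≈ε) (identityʳ _))

module AbelianQuotient {c ℓ : Level} (G : Group c ℓ) where
  open Group G
  open Subgroups G

  module _ {k : Level} {N : Carrier → Set k} (N-sub : IsSubgroup N) (N-normal : IsNormal N) where
    open Quotient N N-sub N-normal
    module G/N = Subgroups quotient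

    quotient-closure-isSubgroup : ∀ {p} (T : Carrier → Set p) → IsSubgroup (G/N.Closure T)
    quotient-closure-isSubgroup T =
      record { ε∈ = G/N.unit ; ∙-closed = G/N.mul ; ⁻¹-closed = G/N.inv ; ∈-resp-≈ = λ q → G/N.resp (≈⇒≈ₙ q) }

    closure-quotient : ∀ {p} {T : Carrier → Set p} {x} → Closure T x → G/N.Closure T x
    closure-quotient = closure-least (quotient-closure-isSubgroup _) G/N.gen

    ⟨⟩-quotient : ∀ {gs x} → ⟨ gs ⟩ x → G/N.⟨ gs ⟩ x
    ⟨⟩-quotient = closure-least (quotient-closure-isSubgroup _) (λ s∈ → G/N.gen (Any.map ≈⇒≈ₙ s∈))

    commutators-∈ : ∀ {p} {T : Carrier → Set p} → (∀ x → G/N.Closure T x) →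
                    (∀ {s t} → T s → T t → N [ s , t ]) → ∀ x y → N [ x , y ]
    commutators-∈ T-generates T-commute x y =
      ≈ₙε⇒∈ (G/N.commute⇒[,]≈ε (G/N.closure-commute
        (λ s∈ t∈ → G/N.[,]≈ε⇒commute (∈⇒≈ₙε (T-commute s∈ t∈))) (T-generates x) (T-generates y)))

    perfect-⊆-normal : IsPerfect → ∀ {p} {T : Carrier → Set p} → (∀ x → G/N.Closure T x) →
                         (∀ {s t} → T s → T t → N [ s , t ]) → ∀ x → N x
    perfect-⊆-normal perfect T-generates T-commute =
      perfect-⊆ perfect N-sub (commutators-∈ T-generates T-commute)

    perfect-⊆-normal₂ : IsPerfect → ∀ {a b} → (∀ x → ⟨ a ∷ b ∷ [] ⟩ x) → N [ a , b ] → ∀ x → N x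
    perfect-⊆-normal₂ perfect {a} {b} generates N∋[a,b] =
      perfect-⊆-normal perfect (λ x → closure-quotient (generates x))
        (generators-pairwise (λ s≈ t≈ → ∈-resp-≈ (sym ([,]-cong s≈ t≈)))
          ( (N∋[,]-self ∷ N∋[a,b] ∷ [])
          ∷ (∈-resp-≈ (sym ([,]-anticomm a b)) (⁻¹-closed N∋[a,b]) ∷ N∋[,]-self ∷ [])
          ∷ []))
      where
      open IsSubgroup N-sub
      N∋[,]-self : ∀ {x} → N [ x , x ]
      N∋[,]-self {x} = ∈-resp-≈ (sym ([,]-self x)) ε∈

    quotient-isPerfect : IsPerfect → G/N.IsPerfect
    quotient-isPerfect perfect x _ = closure-least (quotient-closure-isSubgroup _)
      (λ (a , b , _ , _ , x≈[a,b]) → G/N.gen (a , b , tt , tt , ≈⇒≈ₙ x≈[a,b]))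
      (perfect x tt)

-- Walks in coset graphs

module CosetGraphWalks {c ℓ h : Level} (G : Group c ℓ) {H : Group.Carrier G → Set h}
  (H-sub : Subgroups.IsSubgroup G H) (g : Group.Carrier G) where
  open Group G
  open GroupProperties G using (inverseˡ-unique; ⁻¹-anti-homo-∙)
  open GroupWords G using (solve; x₀; x₁; x₂; x₃; x₄; ε′; _∙′_; _⁻¹′)
  open Subgroups G using (⟨_⟩; closure-least; closure-isSubgroup; IsSubgroup; gen; mul; inv)
  open IsSubgroup H-sub
  open GroupNotions.CosetGraph rawGroup H g
  open SetoidReasoning setoid

  walk-resp : ∀ {x y y′} → Walk x y → y ≈ y′ → Walk x y′
  walk-resp (same Hyx⁻¹) y≈y′ = same (∈-resp-≈ (∙-congʳ y≈y′) Hyx⁻¹)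
  walk-resp (step w (a , b , Ha , Hb , yz⁻¹≈agb)) y≈y′ =
    step w (a , b , Ha , Hb , trans (∙-congʳ (sym y≈y′)) yz⁻¹≈agb)

  walk-extend : ∀ {x y z} → Walk x y → H (z ∙ y ⁻¹) → Walk x z
  walk-extend {x} {y} {z} (same Hyx⁻¹) Hzy⁻¹ =
    same (∈-resp-≈ (solve (x ∷ᵛ y ∷ᵛ z ∷ᵛ []ᵛ) ((x₂ ∙′ x₁ ⁻¹′) ∙′ (x₁ ∙′ x₀ ⁻¹′)) (x₂ ∙′ x₀ ⁻¹′) ≡.refl)
                   (∙-closed Hzy⁻¹ Hyx⁻¹))
  walk-extend {x} {y} {z} (step {z = u} w (a , b , Ha , Hb , yu⁻¹≈agb)) Hzy⁻¹ =
    step w ((z ∙ y ⁻¹) ∙ a , b , ∙-closed Hzy⁻¹ Ha , Hb , (begin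
      z ∙ u ⁻¹                        ≈⟨ solve (u ∷ᵛ y ∷ᵛ z ∷ᵛ []ᵛ) (x₂ ∙′ x₀ ⁻¹′) ((x₂ ∙′ x₁ ⁻¹′) ∙′ (x₁ ∙′ x₀ ⁻¹′)) ≡.refl ⟩
      (z ∙ y ⁻¹) ∙ (y ∙ u ⁻¹)         ≈⟨ ∙-congˡ yu⁻¹≈agb ⟩
      (z ∙ y ⁻¹) ∙ ((a ∙ g) ∙ b)      ≈⟨ solve (z ∷ᵛ y ∷ᵛ a ∷ᵛ g ∷ᵛ b ∷ᵛ []ᵛ) ((x₀ ∙′ x₁ ⁻¹′) ∙′ ((x₂ ∙′ x₃) ∙′ x₄))
                                                 ((((x₀ ∙′ x₁ ⁻¹′) ∙′ x₂) ∙′ x₃) ∙′ x₄) ≡.refl ⟩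
      (((z ∙ y ⁻¹) ∙ a) ∙ g) ∙ b      ∎))

  walk-++ : ∀ {x y z} → Walk x y → Walk y z → Walk x z
  walk-++ w (same Hzy⁻¹)   = walk-extend w Hzy⁻¹
  walk-++ w (step w′ adj) = step (walk-++ w w′) adj

  walk-here : ∀ x → Walk x x
  walk-here x = same (∈-resp-≈ (sym (inverseʳ x)) ε∈)

  walk-≈ : ∀ {x y} → x ≈ y → Walk x y
  walk-≈ {x} x≈y = walk-resp (walk-here x) x≈y

  module _ (g²≈ε : g ∙ g ≈ ε) where

    adj-sym : ∀ {x y} → Adj x y → Adj y x
    adj-sym {x} {y} (a , b , Ha , Hb , yx⁻¹≈agb) = b ⁻¹ , a ⁻¹ , ⁻¹-closed Hb , ⁻¹-closed Ha , (begin
      x ∙ y ⁻¹                   ≈⟨ solve (x ∷ᵛ y ∷ᵛ []ᵛ) (x₀ ∙′ x₁ ⁻¹′) ((x₁ ∙′ x₀ ⁻¹′) ⁻¹′) ≡.refl ⟩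
      (y ∙ x ⁻¹) ⁻¹              ≈⟨ ⁻¹-cong yx⁻¹≈agb ⟩
      ((a ∙ g) ∙ b) ⁻¹           ≈⟨ ⁻¹-anti-homo-∙ (a ∙ g) b ⟩
      b ⁻¹ ∙ (a ∙ g) ⁻¹          ≈⟨ ∙-congˡ (⁻¹-anti-homo-∙ a g) ⟩
      b ⁻¹ ∙ (g ⁻¹ ∙ a ⁻¹)       ≈⟨ assoc _ _ _ ⟨
      (b ⁻¹ ∙ g ⁻¹) ∙ a ⁻¹       ≈⟨ ∙-congʳ (∙-congˡ (sym (inverseˡ-unique g g g²≈ε))) ⟩
      (b ⁻¹ ∙ g) ∙ a ⁻¹          ∎)

    walk-reverse : ∀ {x y} → Walk x y → Walk y x
    walk-reverse {x} {y} (same Hyx⁻¹) =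
      same (∈-resp-≈ (solve (x ∷ᵛ y ∷ᵛ []ᵛ) ((x₁ ∙′ x₀ ⁻¹′) ⁻¹′) (x₀ ∙′ x₁ ⁻¹′) ≡.refl) (⁻¹-closed Hyx⁻¹))
    walk-reverse {x} {y} (step w adj) = walk-++ (step (walk-here y) (adj-sym adj)) (walk-reverse w)

    Translation : Carrier → Set (c ⊔ ℓ ⊔ h)
    Translation z = ∀ x → Walk x (z ∙ x)

    translations-isSubgroup : IsSubgroup Translation
    translations-isSubgroup = record
      { ε∈        = λ x → walk-resp (walk-here x) (sym (identityˡ x))
      ; ∙-closed  = λ {z} {z′} t t′ x → walk-resp (walk-++ (t′ x) (t (z′ ∙ x))) (sym (assoc z z′ x))
      ; ⁻¹-closed = λ {z} t x →
          walk-++ (walk-≈ (solve (z ∷ᵛ x ∷ᵛ []ᵛ) x₁ (x₀ ∙′ (x₀ ⁻¹′ ∙′ x₁)) ≡.refl)) (walk-reverse (t (z ⁻¹ ∙ x)))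
      ; ∈-resp-≈  = λ z≈z′ t x → walk-resp (t x) (∙-congʳ z≈z′)
      }

    translation-g : Translation g
    translation-g x = step (walk-here x)
      (ε , ε , ε∈ , ε∈ , solve (g ∷ᵛ x ∷ᵛ []ᵛ) ((x₀ ∙′ x₁) ∙′ x₁ ⁻¹′) ((ε′ ∙′ x₀) ∙′ ε′) ≡.refl)

    translation-H : ∀ {z} → H z → Translation z
    translation-H {z} Hz x = same (∈-resp-≈ (solve (z ∷ᵛ x ∷ᵛ []ᵛ) x₀ ((x₀ ∙′ x₁) ∙′ x₁ ⁻¹′) ≡.refl) Hz)

    connected : ∀ {h′ k} {K : Carrier → Set k} → H h′ → (∀ x → K x → ⟨ g ∷ h′ ∷ [] ⟩ x) → Connected K
    connected {h′} Hh′ K⊆⟨g,h′⟩ x y Kx Ky =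
      walk-resp (translation (mul (K⊆⟨g,h′⟩ y Ky) (inv (K⊆⟨g,h′⟩ x Kx))) x)
                (solve (x ∷ᵛ y ∷ᵛ []ᵛ) ((x₁ ∙′ x₀ ⁻¹′) ∙′ x₀) x₁ ≡.refl)
      where
      translation : ∀ {z} → ⟨ g ∷ h′ ∷ [] ⟩ z → Translation z
      translation = closure-least translations-isSubgroup λ
        { (here z≈g)         → IsSubgroup.∈-resp-≈ translations-isSubgroup (sym z≈g) translation-g
        ; (there (here z≈h′)) → IsSubgroup.∈-resp-≈ translations-isSubgroup (sym z≈h′) (translation-H Hh′) }

-- Words in an involution μ and an element λ of order 3

data Letter : Set where
  `μ `λ `λ⁻¹ : Letter

-- Reduction in the free product ⟨ μ ∣ μ² ⟩ ∗ ⟨ λ ∣ λ³ ⟩.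
consᴹ : Letter → List Letter → List Letter
consᴹ `μ   (`μ ∷ w)   = w
consᴹ `λ   (`λ ∷ w)   = `λ⁻¹ ∷ w
consᴹ `λ   (`λ⁻¹ ∷ w) = w
consᴹ `λ⁻¹ (`λ ∷ w)   = w
consᴹ `λ⁻¹ (`λ⁻¹ ∷ w) = `λ ∷ w
consᴹ x    w          = x ∷ w

reduce : List Letter → List Letter
reduce = foldr consᴹ []

invertᴸ : Letter → Letter
invertᴸ `μ   = `μ
invertᴸ `λ   = `λ⁻¹
invertᴸ `λ⁻¹ = `λ

invert : List Letter → List Letter
invert []      = []
invert (x ∷ w) = invert w ++ (invertᴸ x ∷ [])

relatorProduct : List (List Letter × Bool) → List Letter → List Letter
relatorProduct []             r = []
relatorProduct ((p , s) ∷ ps) r = p ++ ((if s then r else invert r) ++ (invert p ++ relatorProduct ps r))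

λμ-power : ℕ → List Letter
λμ-power zero    = []
λμ-power (suc n) = `λ ∷ `μ ∷ λμ-power n

module TwoThreeWords {c ℓ : Level} (G : Group c ℓ) (μ la : Group.Carrier G) where
  open Group G
  open GroupProperties G using (inverseˡ-unique; ⁻¹-involutive; ⁻¹-anti-homo-∙; ε⁻¹≈ε)
  open GroupWords G using (solve; x₀; ε′; _∙′_; _⁻¹′)
  open SetoidReasoning setoid

  ⟦_⟧ᴸ : Letter → Carrier
  ⟦ `μ ⟧ᴸ   = μ
  ⟦ `λ ⟧ᴸ   = la
  ⟦ `λ⁻¹ ⟧ᴸ = la ⁻¹

  ⟦_⟧ : List Letter → Carrier
  ⟦ [] ⟧    = ε
  ⟦ x ∷ w ⟧ = ⟦ x ⟧ᴸ ∙ ⟦ w ⟧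

  ++-homo : ∀ u w → ⟦ u ++ w ⟧ ≈ ⟦ u ⟧ ∙ ⟦ w ⟧
  ++-homo []      w = sym (identityˡ _)
  ++-homo (x ∷ u) w = trans (∙-congˡ (++-homo u w)) (sym (assoc _ _ _))

  μ⁻¹≈μ : μ ∙ μ ≈ ε → μ ⁻¹ ≈ μ
  μ⁻¹≈μ μ²≈ε = sym (inverseˡ-unique μ μ μ²≈ε)

  module _ (μ²≈ε : μ ∙ μ ≈ ε) (λ³≈ε : (la ∙ la) ∙ la ≈ ε) where

    λ²≈λ⁻¹ : la ∙ la ≈ la ⁻¹
    λ²≈λ⁻¹ = begin
      la ∙ la                   ≈⟨ solve (la ∷ᵛ []ᵛ) (x₀ ∙′ x₀) (((x₀ ∙′ x₀) ∙′ x₀) ∙′ x₀ ⁻¹′) ≡.refl ⟩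
      ((la ∙ la) ∙ la) ∙ la ⁻¹  ≈⟨ ∙-congʳ λ³≈ε ⟩
      ε ∙ la ⁻¹                 ≈⟨ identityˡ _ ⟩
      la ⁻¹                     ∎

    λ⁻²≈λ : la ⁻¹ ∙ la ⁻¹ ≈ la
    λ⁻²≈λ = begin
      la ⁻¹ ∙ la ⁻¹             ≈⟨ ∙-cong λ²≈λ⁻¹ λ²≈λ⁻¹ ⟨
      (la ∙ la) ∙ (la ∙ la)     ≈⟨ solve (la ∷ᵛ []ᵛ) ((x₀ ∙′ x₀) ∙′ (x₀ ∙′ x₀)) (((x₀ ∙′ x₀) ∙′ x₀) ∙′ x₀) ≡.refl ⟩
      ((la ∙ la) ∙ la) ∙ la     ≈⟨ ∙-congʳ λ³≈ε ⟩
      ε ∙ la                    ≈⟨ identityˡ _ ⟩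
      la                        ∎

    private
      cancel : ∀ {a b} w → a ∙ b ≈ ε → ⟦ w ⟧ ≈ a ∙ (b ∙ ⟦ w ⟧)
      cancel w ab≈ε = sym (trans (sym (assoc _ _ _)) (trans (∙-congʳ ab≈ε) (identityˡ _)))

      merge : ∀ {a b d} w → a ∙ b ≈ d → d ∙ ⟦ w ⟧ ≈ a ∙ (b ∙ ⟦ w ⟧)
      merge w ab≈d = sym (trans (sym (assoc _ _ _)) (∙-congʳ ab≈d))

    consᴹ-homo : ∀ x w → ⟦ consᴹ x w ⟧ ≈ ⟦ x ⟧ᴸ ∙ ⟦ w ⟧
    consᴹ-homo `μ   (`μ ∷ w)   = cancel w μ²≈ε
    consᴹ-homo `λ   (`λ ∷ w)   = merge w λ²≈λ⁻¹
    consᴹ-homo `λ   (`λ⁻¹ ∷ w) = cancel w (inverseʳ la)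
    consᴹ-homo `λ⁻¹ (`λ ∷ w)   = cancel w (inverseˡ la)
    consᴹ-homo `λ⁻¹ (`λ⁻¹ ∷ w) = merge w λ⁻²≈λ
    consᴹ-homo `μ   []         = refl
    consᴹ-homo `μ   (`λ ∷ w)   = refl
    consᴹ-homo `μ   (`λ⁻¹ ∷ w) = refl
    consᴹ-homo `λ   []         = refl
    consᴹ-homo `λ   (`μ ∷ w)   = refl
    consᴹ-homo `λ⁻¹ []         = refl
    consᴹ-homo `λ⁻¹ (`μ ∷ w)   = refl

    reduce-sound : ∀ w → ⟦ reduce w ⟧ ≈ ⟦ w ⟧
    reduce-sound []      = refl
    reduce-sound (x ∷ w) = trans (consᴹ-homo x (reduce w)) (∙-congˡ (reduce-sound w))

    reduce-≡⇒≈ : ∀ u w → reduce u ≡ reduce w → ⟦ u ⟧ ≈ ⟦ w ⟧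
    reduce-≡⇒≈ u w eq = trans (sym (reduce-sound u)) (trans (reflexive (≡.cong ⟦_⟧ eq)) (reduce-sound w))

    invertᴸ-homo : ∀ x → ⟦ invertᴸ x ⟧ᴸ ≈ ⟦ x ⟧ᴸ ⁻¹
    invertᴸ-homo `μ   = sym (μ⁻¹≈μ μ²≈ε)
    invertᴸ-homo `λ   = refl
    invertᴸ-homo `λ⁻¹ = sym (⁻¹-involutive la)

    invert-homo : ∀ w → ⟦ invert w ⟧ ≈ ⟦ w ⟧ ⁻¹
    invert-homo []      = sym ε⁻¹≈ε
    invert-homo (x ∷ w) = begin
      ⟦ invert w ++ (invertᴸ x ∷ []) ⟧     ≈⟨ ++-homo (invert w) _ ⟩
      ⟦ invert w ⟧ ∙ (⟦ invertᴸ x ⟧ᴸ ∙ ε)  ≈⟨ ∙-cong (invert-homo w) (trans (identityʳ _) (invertᴸ-homo x)) ⟩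
      ⟦ w ⟧ ⁻¹ ∙ ⟦ x ⟧ᴸ ⁻¹                 ≈⟨ ⁻¹-anti-homo-∙ _ _ ⟨
      (⟦ x ⟧ᴸ ∙ ⟦ w ⟧) ⁻¹                  ∎

    conjugate-word : ∀ x w → (⟦ x ⟧ᴸ ⁻¹ ∙ ⟦ w ⟧) ∙ ⟦ x ⟧ᴸ ≈ ⟦ invertᴸ x ∷ (w ++ x ∷ []) ⟧
    conjugate-word x w = begin
      (⟦ x ⟧ᴸ ⁻¹ ∙ ⟦ w ⟧) ∙ ⟦ x ⟧ᴸ          ≈⟨ assoc _ _ _ ⟩
      ⟦ x ⟧ᴸ ⁻¹ ∙ (⟦ w ⟧ ∙ ⟦ x ⟧ᴸ)          ≈⟨ ∙-cong (invertᴸ-homo x) (∙-congˡ (identityʳ _)) ⟨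
      ⟦ invertᴸ x ⟧ᴸ ∙ (⟦ w ⟧ ∙ ⟦ x ∷ [] ⟧)  ≈⟨ ∙-congˡ (++-homo w (x ∷ [])) ⟨
      ⟦ invertᴸ x ∷ (w ++ x ∷ []) ⟧         ∎

    conjugate-word′ : ∀ x w → (⟦ x ⟧ᴸ ∙ ⟦ w ⟧) ∙ ⟦ x ⟧ᴸ ⁻¹ ≈ ⟦ x ∷ (w ++ invertᴸ x ∷ []) ⟧
    conjugate-word′ x w = begin
      (⟦ x ⟧ᴸ ∙ ⟦ w ⟧) ∙ ⟦ x ⟧ᴸ ⁻¹                  ≈⟨ assoc _ _ _ ⟩
      ⟦ x ⟧ᴸ ∙ (⟦ w ⟧ ∙ ⟦ x ⟧ᴸ ⁻¹)                  ≈⟨ ∙-congˡ (∙-congˡ (trans (identityʳ _) (invertᴸ-homo x))) ⟨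
      ⟦ x ⟧ᴸ ∙ (⟦ w ⟧ ∙ ⟦ invertᴸ x ∷ [] ⟧)         ≈⟨ ∙-congˡ (++-homo w (invertᴸ x ∷ [])) ⟨
      ⟦ x ∷ (w ++ invertᴸ x ∷ []) ⟧                 ∎

    module _ (r : List Letter) (r≈ε : ⟦ r ⟧ ≈ ε) where

      relatorProduct≈ε : ∀ ps → ⟦ relatorProduct ps r ⟧ ≈ ε
      relatorProduct≈ε []             = refl
      relatorProduct≈ε ((p , s) ∷ ps) = begin
        ⟦ p ++ (rˢ ++ (invert p ++ rest)) ⟧           ≈⟨ ++-homo p _ ⟩
        ⟦ p ⟧ ∙ ⟦ rˢ ++ (invert p ++ rest) ⟧          ≈⟨ ∙-congˡ (++-homo rˢ _) ⟩
        ⟦ p ⟧ ∙ (⟦ rˢ ⟧ ∙ ⟦ invert p ++ rest ⟧)       ≈⟨ ∙-congˡ (∙-cong (rˢ≈ε s) (++-homo (invert p) rest)) ⟩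
        ⟦ p ⟧ ∙ (ε ∙ (⟦ invert p ⟧ ∙ ⟦ rest ⟧))       ≈⟨ ∙-congˡ (∙-congˡ (∙-cong (invert-homo p) (relatorProduct≈ε ps))) ⟩
        ⟦ p ⟧ ∙ (ε ∙ (⟦ p ⟧ ⁻¹ ∙ ε))                 ≈⟨ solve (⟦ p ⟧ ∷ᵛ []ᵛ) (x₀ ∙′ (ε′ ∙′ (x₀ ⁻¹′ ∙′ ε′))) ε′ ≡.refl ⟩
        ε                                             ∎
        where
        rˢ rest : List Letter
        rˢ   = if s then r else invert r
        rest = relatorProduct ps r
        rˢ≈ε : ∀ s → ⟦ if s then r else invert r ⟧ ≈ ε
        rˢ≈ε true  = r≈ε
        rˢ≈ε false = trans (invert-homo r) (trans (⁻¹-cong r≈ε) ε⁻¹≈ε)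

      -- An identity u = w holding in ⟨ μ , λ ∣ μ² , λ³ , r ⟩, certified by the conjugates
      -- of r that turn w into u in the free product.
      certify : ∀ u w ps → reduce u ≡ reduce (relatorProduct ps r ++ w) → ⟦ u ⟧ ≈ ⟦ w ⟧
      certify u w ps eq = begin
        ⟦ u ⟧                                 ≈⟨ reduce-≡⇒≈ u (relatorProduct ps r ++ w) eq ⟩
        ⟦ relatorProduct ps r ++ w ⟧          ≈⟨ ++-homo (relatorProduct ps r) w ⟩
        ⟦ relatorProduct ps r ⟧ ∙ ⟦ w ⟧       ≈⟨ ∙-congʳ (relatorProduct≈ε ps) ⟩
        ε ∙ ⟦ w ⟧                             ≈⟨ identityˡ _ ⟩
        ⟦ w ⟧                                 ∎

-- Perfect groups generated by μ and λ

module TwoGeneratedPerfect {c ℓ : Level} (Q : Group c ℓ) (μ la : Group.Carrier Q) where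
  open Group Q
  open GroupWords Q using (solve; x₀; x₁; ε′; _∙′_; _⁻¹′)
  open Subgroups Q
  open AbelianQuotient Q
  open TwoThreeWords Q μ la using (μ⁻¹≈μ)
  open SetoidReasoning setoid

  μλμ : Carrier
  μλμ = (μ ∙ la) ∙ μ

  module _ (perfect : IsPerfect) (generates : ∀ x → ⟨ μ ∷ la ∷ [] ⟩ x) (μ²≈ε : μ ∙ μ ≈ ε) where

    λ-and-μλμ-generate : ∀ x → ⟨ la ∷ μλμ ∷ [] ⟩ x
    λ-and-μλμ-generate = perfect-⊆-normal₂ E-isSubgroup E-normal perfect generates E∋[μ,λ]
      where
      E : Carrier → Set (c ⊔ ℓ)
      E = ⟨ la ∷ μλμ ∷ [] ⟩
      E-isSubgroup : IsSubgroup E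
      E-isSubgroup = closure-isSubgroup _
      λ∈ : E la
      λ∈ = gen (here refl)
      μλμ∈ : E μλμ
      μλμ∈ = gen (there (here refl))

      conjugates-by-μ : ∀ {x} → E ((μ ∙ x) ∙ μ) → E (x ^ μ) × E ((μ ∙ x) ∙ μ ⁻¹)
      conjugates-by-μ μxμ∈ = resp (sym (∙-congʳ (∙-congʳ (μ⁻¹≈μ μ²≈ε)))) μxμ∈
                           , resp (sym (∙-congˡ (μ⁻¹≈μ μ²≈ε))) μxμ∈

      μμλμμ≈λ : (μ ∙ μλμ) ∙ μ ≈ la
      μμλμμ≈λ = begin
        (μ ∙ ((μ ∙ la) ∙ μ)) ∙ μ
          ≈⟨ solve (μ ∷ᵛ la ∷ᵛ []ᵛ) ((x₀ ∙′ ((x₀ ∙′ x₁) ∙′ x₀)) ∙′ x₀) ((x₀ ∙′ x₀) ∙′ (x₁ ∙′ (x₀ ∙′ x₀))) ≡.refl ⟩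
        (μ ∙ μ) ∙ (la ∙ (μ ∙ μ))   ≈⟨ ∙-cong μ²≈ε (∙-congˡ μ²≈ε) ⟩
        ε ∙ (la ∙ ε)               ≈⟨ solve (la ∷ᵛ []ᵛ) (ε′ ∙′ (x₀ ∙′ ε′)) x₀ ≡.refl ⟩
        la                         ∎

      E-normal : IsNormal E
      E-normal = ⟨⟩-isNormal
        ( (conjugates-by-μ μλμ∈ ∷ conjugates-by-μ (resp (sym μμλμμ≈λ) λ∈) ∷ [])
        ∷ ( ( resp (solve (la ∷ᵛ []ᵛ) x₀ ((x₀ ⁻¹′ ∙′ x₀) ∙′ x₀) ≡.refl) λ∈
            , resp (solve (la ∷ᵛ []ᵛ) x₀ ((x₀ ∙′ x₀) ∙′ x₀ ⁻¹′) ≡.refl) λ∈)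
          ∷ (mul (mul (inv λ∈) μλμ∈) λ∈ , mul (mul λ∈ μλμ∈) (inv λ∈))
          ∷ [])
        ∷ [])
        generates

      E∋[μ,λ] : E [ μ , la ]
      E∋[μ,λ] = resp (sym (begin
        (μ ⁻¹ ∙ la ⁻¹) ∙ (μ ∙ la)      ≈⟨ ∙-congˡ (∙-congʳ (μ⁻¹≈μ μ²≈ε)) ⟨
        (μ ⁻¹ ∙ la ⁻¹) ∙ (μ ⁻¹ ∙ la)
          ≈⟨ solve (μ ∷ᵛ la ∷ᵛ []ᵛ) ((x₀ ⁻¹′ ∙′ x₁ ⁻¹′) ∙′ (x₀ ⁻¹′ ∙′ x₁)) (((x₀ ∙′ x₁) ∙′ x₀) ⁻¹′ ∙′ x₁) ≡.refl ⟩
        μλμ ⁻¹ ∙ la                    ∎)) (mul (inv μλμ∈) λ∈)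

  module _ (perfect : IsPerfect) (generates : ∀ x → ⟨ μ ∷ la ∷ [] ⟩ x)
           (μ²≈ε : μ ∙ μ ≈ ε) (λ³≈ε : (la ∙ la) ∙ la ≈ ε) where
    open TwoThreeWords Q μ la hiding (μ⁻¹≈μ)

    -- In Δ(2,3,6) = ⟨ μ , λ ∣ μ² , λ³ , (λμ)⁶ ⟩ the elements τ₁ = [μ , λ] and τ₂ = μλμλ⁻¹ commute
    -- and generate a normal subgroup with abelian quotient; so a perfect quotient of Δ(2,3,6) is abelian,
    -- hence trivial.
    Δ236-perfect-quotient-trivial : ⟦ λμ-power 6 ⟧ ≈ ε → ∀ x → x ≈ ε
    Δ236-perfect-quotient-trivial r≈ε =
      abelian-perfect⇒trivial perfect (λ x y → closure-commute τ-commute (τ-generate x) (τ-generate y))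
      where
      τ₁ʷ τ₂ʷ : List Letter
      τ₁ʷ = `μ ∷ `λ⁻¹ ∷ `μ ∷ `λ ∷ []
      τ₂ʷ = `μ ∷ `λ ∷ `μ ∷ `λ⁻¹ ∷ []

      E : Carrier → Set (c ⊔ ℓ)
      E = ⟨ ⟦ τ₁ʷ ⟧ ∷ ⟦ τ₂ʷ ⟧ ∷ [] ⟩
      E-isSubgroup : IsSubgroup E
      E-isSubgroup = closure-isSubgroup _

      ≈-certified : ∀ u w ps → reduce u ≡ reduce (relatorProduct ps (λμ-power 6) ++ w) → ⟦ u ⟧ ≈ ⟦ w ⟧
      ≈-certified = certify μ²≈ε λ³≈ε (λμ-power 6) r≈ε

      τ₁∈ : E ⟦ τ₁ʷ ⟧
      τ₁∈ = gen (here refl)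
      τ₂∈ : E ⟦ τ₂ʷ ⟧
      τ₂∈ = gen (there (here refl))
      invert-∈ : ∀ w → E ⟦ w ⟧ → E ⟦ invert w ⟧
      invert-∈ w w∈ = resp (sym (invert-homo μ²≈ε λ³≈ε w)) (inv w∈)
      ++-∈ : ∀ u w → E ⟦ u ⟧ → E ⟦ w ⟧ → E ⟦ u ++ w ⟧
      ++-∈ u w u∈ w∈ = resp (sym (++-homo u w)) (mul u∈ w∈)

      conjugates-∈ : ∀ x w → E ⟦ invertᴸ x ∷ (w ++ x ∷ []) ⟧ → E ⟦ x ∷ (w ++ invertᴸ x ∷ []) ⟧ →
                     E ((⟦ x ⟧ᴸ ⁻¹ ∙ ⟦ w ⟧) ∙ ⟦ x ⟧ᴸ) × E ((⟦ x ⟧ᴸ ∙ ⟦ w ⟧) ∙ ⟦ x ⟧ᴸ ⁻¹)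
      conjugates-∈ x w p q = resp (sym (conjugate-word μ²≈ε λ³≈ε x w)) p
                             , resp (sym (conjugate-word′ μ²≈ε λ³≈ε x w)) q

      τ₁⁻¹∈ : E ⟦ invert τ₁ʷ ⟧
      τ₁⁻¹∈ = invert-∈ τ₁ʷ τ₁∈
      τ₂⁻¹∈ : E ⟦ invert τ₂ʷ ⟧
      τ₂⁻¹∈ = invert-∈ τ₂ʷ τ₂∈

      -- Each conjugate of a τ by a generator is rewritten, in Δ(2,3,6), as a word in the τ's;
      -- the third argument of `via` lists the conjugates of the relator (λμ)⁶ that are needed.
      E-normal : IsNormal E
      E-normal = ⟨⟩-isNormal
        ( (conjugates-∈ `μ τ₁ʷ μτ₁μ∈ μτ₁μ∈ ∷ conjugates-∈ `μ τ₂ʷ μτ₂μ∈ μτ₂μ∈ ∷ [])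
          ∷ (conjugates-∈ `λ τ₁ʷ λ⁻¹τ₁λ∈ λτ₁λ⁻¹∈ ∷ conjugates-∈ `λ τ₂ʷ λ⁻¹τ₂λ∈ λτ₂λ⁻¹∈ ∷ [])
          ∷ [])
        generates
        where
        via : ∀ u w ps → reduce u ≡ reduce (relatorProduct ps (λμ-power 6) ++ w) → E ⟦ w ⟧ → E ⟦ u ⟧
        via u w ps eq w∈ = resp (sym (≈-certified u w ps eq)) w∈

        μτ₁μ∈ : E ⟦ `μ ∷ (τ₁ʷ ++ `μ ∷ []) ⟧
        μτ₁μ∈ = via (`μ ∷ (τ₁ʷ ++ `μ ∷ [])) (invert τ₁ʷ) [] ≡.refl τ₁⁻¹∈
        μτ₂μ∈ : E ⟦ `μ ∷ (τ₂ʷ ++ `μ ∷ []) ⟧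
        μτ₂μ∈ = via (`μ ∷ (τ₂ʷ ++ `μ ∷ [])) (invert τ₂ʷ) [] ≡.refl τ₂⁻¹∈
        λ⁻¹τ₁λ∈ : E ⟦ `λ⁻¹ ∷ (τ₁ʷ ++ `λ ∷ []) ⟧
        λ⁻¹τ₁λ∈ = via (`λ⁻¹ ∷ (τ₁ʷ ++ `λ ∷ [])) (τ₂ʷ ++ invert τ₁ʷ) ((`λ⁻¹ ∷ [] , false) ∷ []) ≡.refl
                      (++-∈ τ₂ʷ (invert τ₁ʷ) τ₂∈ τ₁⁻¹∈)
        λ⁻¹τ₂λ∈ : E ⟦ `λ⁻¹ ∷ (τ₂ʷ ++ `λ ∷ []) ⟧
        λ⁻¹τ₂λ∈ = via (`λ⁻¹ ∷ (τ₂ʷ ++ `λ ∷ [])) (invert τ₁ʷ) [] ≡.refl τ₁⁻¹∈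
        λτ₁λ⁻¹∈ : E ⟦ `λ ∷ (τ₁ʷ ++ `λ⁻¹ ∷ []) ⟧
        λτ₁λ⁻¹∈ = via (`λ ∷ (τ₁ʷ ++ `λ⁻¹ ∷ [])) (invert τ₂ʷ) [] ≡.refl τ₂⁻¹∈
        λτ₂λ⁻¹∈ : E ⟦ `λ ∷ (τ₂ʷ ++ `λ⁻¹ ∷ []) ⟧
        λτ₂λ⁻¹∈ = via (`λ ∷ (τ₂ʷ ++ `λ⁻¹ ∷ [])) (τ₁ʷ ++ invert τ₂ʷ) (([] , true) ∷ []) ≡.refl
                      (++-∈ τ₁ʷ (invert τ₂ʷ) τ₁∈ τ₂⁻¹∈)

      E∋[μ,λ] : E [ μ , la ]
      E∋[μ,λ] = resp (sym (begin
        (μ ⁻¹ ∙ la ⁻¹) ∙ (μ ∙ la)   ≈⟨ ∙-congʳ (∙-congʳ (μ⁻¹≈μ μ²≈ε)) ⟩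
        (μ ∙ la ⁻¹) ∙ (μ ∙ la)
          ≈⟨ solve (μ ∷ᵛ la ∷ᵛ []ᵛ) ((x₀ ∙′ x₁ ⁻¹′) ∙′ (x₀ ∙′ x₁)) (x₀ ∙′ (x₁ ⁻¹′ ∙′ (x₀ ∙′ (x₁ ∙′ ε′)))) ≡.refl ⟩
        ⟦ τ₁ʷ ⟧                     ∎)) τ₁∈

      τ-generate : ∀ x → E x
      τ-generate = perfect-⊆-normal₂ E-isSubgroup E-normal perfect generates E∋[μ,λ]

      τ₁τ₂≈τ₂τ₁ : Commute ⟦ τ₁ʷ ⟧ ⟦ τ₂ʷ ⟧
      τ₁τ₂≈τ₂τ₁ = [,]≈ε⇒commute (begin
        [ ⟦ τ₁ʷ ⟧ , ⟦ τ₂ʷ ⟧ ]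
          ≈⟨ ∙-cong (∙-cong (invert-homo μ²≈ε λ³≈ε τ₁ʷ) (invert-homo μ²≈ε λ³≈ε τ₂ʷ)) (++-homo τ₁ʷ τ₂ʷ) ⟨
        (⟦ invert τ₁ʷ ⟧ ∙ ⟦ invert τ₂ʷ ⟧) ∙ ⟦ τ₁ʷ ++ τ₂ʷ ⟧
          ≈⟨ ∙-congʳ (++-homo (invert τ₁ʷ) (invert τ₂ʷ)) ⟨
        ⟦ invert τ₁ʷ ++ invert τ₂ʷ ⟧ ∙ ⟦ τ₁ʷ ++ τ₂ʷ ⟧
          ≈⟨ ++-homo (invert τ₁ʷ ++ invert τ₂ʷ) (τ₁ʷ ++ τ₂ʷ) ⟨
        ⟦ (invert τ₁ʷ ++ invert τ₂ʷ) ++ (τ₁ʷ ++ τ₂ʷ) ⟧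
          ≈⟨ ≈-certified ((invert τ₁ʷ ++ invert τ₂ʷ) ++ (τ₁ʷ ++ τ₂ʷ)) [] ((`λ⁻¹ ∷ `μ ∷ [] , true) ∷ []) ≡.refl ⟩
        ε ∎)

      τ-commute : ∀ {s t} → Any (s ≈_) (⟦ τ₁ʷ ⟧ ∷ ⟦ τ₂ʷ ⟧ ∷ []) → Any (t ≈_) (⟦ τ₁ʷ ⟧ ∷ ⟦ τ₂ʷ ⟧ ∷ []) → Commute s t
      τ-commute = generators-pairwise {R = Commute}
        (λ s≈ t≈ c → trans (∙-cong s≈ t≈) (trans c (sym (∙-cong t≈ s≈))))
        ( (refl ∷ τ₁τ₂≈τ₂τ₁ ∷ []) ∷ (sym τ₁τ₂≈τ₂τ₁ ∷ refl ∷ []) ∷ [])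

-- The tops of g and h₁ generate A₅

Table : Set
Table = Fin 5 → Fin 5

_≗?_ : (f h : Table) → Dec (f ≗ h)
f ≗? h = ∀-fin? (λ i → f i ≟ᶠ h i)

bwd-cong : ∀ (π σ : Perm5) → fwd π ≗ fwd σ → bwd π ≗ bwd σ
bwd-cong π σ eq j = ≡.trans (≡.sym (left σ (bwd π j))) (≡.cong (bwd σ) (≡.trans (≡.sym (eq (bwd π j))) (right π j)))

fix⇒bwd : ∀ π {i} → fwd π i ≡ i → bwd π i ≡ i
fix⇒bwd π {i} eq = ≡.trans (≡.cong (bwd π) (≡.sym eq)) (left π i)

≗-by-cases : ∀ {f h : Table} → f p1 ≡ h p1 → f p2 ≡ h p2 → f p3 ≡ h p3 → f p4 ≡ h p4 → f p5 ≡ h p5 → f ≗ h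
≗-by-cases e₁ e₂ e₃ e₄ e₅ p1 = e₁
≗-by-cases e₁ e₂ e₃ e₄ e₅ p2 = e₂
≗-by-cases e₁ e₂ e₃ e₄ e₅ p3 = e₃
≗-by-cases e₁ e₂ e₃ e₄ e₅ p4 = e₄
≗-by-cases e₁ e₂ e₃ e₄ e₅ p5 = e₅

data Gen : Set where
  `g `h : Gen

topOf : Gen → Perm5
topOf `g = perm14-25
topOf `h = cyc123

wordPerm : List Gen → Perm5
wordPerm []      = idP
wordPerm (x ∷ w) = topOf x ⨾ wordPerm w

-- One word in (1 4)(2 5) and (1 2 3) for each element of A₅.
alternatingWords : List (List Gen)
alternatingWords =
  [] ∷ (`g ∷ []) ∷ (`h ∷ []) ∷ (`g ∷ `h ∷ []) ∷ (`h ∷ `g ∷ []) ∷ (`h ∷ `h ∷ []) ∷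
  (`g ∷ `h ∷ `g ∷ []) ∷ (`g ∷ `h ∷ `h ∷ []) ∷ (`h ∷ `g ∷ `h ∷ []) ∷ (`h ∷ `h ∷ `g ∷ []) ∷
  (`g ∷ `h ∷ `g ∷ `h ∷ []) ∷ (`g ∷ `h ∷ `h ∷ `g ∷ []) ∷ (`h ∷ `g ∷ `h ∷ `g ∷ []) ∷
  (`h ∷ `g ∷ `h ∷ `h ∷ []) ∷ (`h ∷ `h ∷ `g ∷ `h ∷ []) ∷ (`g ∷ `h ∷ `g ∷ `h ∷ `g ∷ []) ∷
  (`g ∷ `h ∷ `g ∷ `h ∷ `h ∷ []) ∷ (`g ∷ `h ∷ `h ∷ `g ∷ `h ∷ []) ∷ (`h ∷ `g ∷ `h ∷ `g ∷ `h ∷ []) ∷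
  (`h ∷ `g ∷ `h ∷ `h ∷ `g ∷ []) ∷ (`h ∷ `h ∷ `g ∷ `h ∷ `g ∷ []) ∷ (`h ∷ `h ∷ `g ∷ `h ∷ `h ∷ []) ∷
  (`g ∷ `h ∷ `g ∷ `h ∷ `g ∷ `h ∷ []) ∷ (`g ∷ `h ∷ `g ∷ `h ∷ `h ∷ `g ∷ []) ∷
  (`g ∷ `h ∷ `h ∷ `g ∷ `h ∷ `g ∷ []) ∷ (`g ∷ `h ∷ `h ∷ `g ∷ `h ∷ `h ∷ []) ∷
  (`h ∷ `g ∷ `h ∷ `g ∷ `h ∷ `h ∷ []) ∷ (`h ∷ `g ∷ `h ∷ `h ∷ `g ∷ `h ∷ []) ∷
  (`h ∷ `h ∷ `g ∷ `h ∷ `g ∷ `h ∷ []) ∷ (`g ∷ `h ∷ `g ∷ `h ∷ `g ∷ `h ∷ `h ∷ []) ∷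
  (`g ∷ `h ∷ `g ∷ `h ∷ `h ∷ `g ∷ `h ∷ []) ∷ (`g ∷ `h ∷ `h ∷ `g ∷ `h ∷ `g ∷ `h ∷ []) ∷
  (`h ∷ `g ∷ `h ∷ `g ∷ `h ∷ `h ∷ `g ∷ []) ∷ (`h ∷ `g ∷ `h ∷ `h ∷ `g ∷ `h ∷ `g ∷ []) ∷
  (`h ∷ `g ∷ `h ∷ `h ∷ `g ∷ `h ∷ `h ∷ []) ∷ (`h ∷ `h ∷ `g ∷ `h ∷ `g ∷ `h ∷ `h ∷ []) ∷
  (`g ∷ `h ∷ `g ∷ `h ∷ `g ∷ `h ∷ `h ∷ `g ∷ []) ∷ (`g ∷ `h ∷ `g ∷ `h ∷ `h ∷ `g ∷ `h ∷ `g ∷ []) ∷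
  (`g ∷ `h ∷ `g ∷ `h ∷ `h ∷ `g ∷ `h ∷ `h ∷ []) ∷ (`g ∷ `h ∷ `h ∷ `g ∷ `h ∷ `g ∷ `h ∷ `h ∷ []) ∷
  (`h ∷ `g ∷ `h ∷ `g ∷ `h ∷ `h ∷ `g ∷ `h ∷ []) ∷ (`h ∷ `g ∷ `h ∷ `h ∷ `g ∷ `h ∷ `g ∷ `h ∷ []) ∷
  (`h ∷ `h ∷ `g ∷ `h ∷ `g ∷ `h ∷ `h ∷ `g ∷ []) ∷
  (`g ∷ `h ∷ `g ∷ `h ∷ `g ∷ `h ∷ `h ∷ `g ∷ `h ∷ []) ∷
  (`g ∷ `h ∷ `g ∷ `h ∷ `h ∷ `g ∷ `h ∷ `g ∷ `h ∷ []) ∷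
  (`g ∷ `h ∷ `h ∷ `g ∷ `h ∷ `g ∷ `h ∷ `h ∷ `g ∷ []) ∷
  (`h ∷ `g ∷ `h ∷ `g ∷ `h ∷ `h ∷ `g ∷ `h ∷ `g ∷ []) ∷
  (`h ∷ `g ∷ `h ∷ `g ∷ `h ∷ `h ∷ `g ∷ `h ∷ `h ∷ []) ∷
  (`h ∷ `g ∷ `h ∷ `h ∷ `g ∷ `h ∷ `g ∷ `h ∷ `h ∷ []) ∷
  (`h ∷ `h ∷ `g ∷ `h ∷ `g ∷ `h ∷ `h ∷ `g ∷ `h ∷ []) ∷
  (`g ∷ `h ∷ `g ∷ `h ∷ `g ∷ `h ∷ `h ∷ `g ∷ `h ∷ `g ∷ []) ∷
  (`g ∷ `h ∷ `g ∷ `h ∷ `g ∷ `h ∷ `h ∷ `g ∷ `h ∷ `h ∷ []) ∷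
  (`g ∷ `h ∷ `g ∷ `h ∷ `h ∷ `g ∷ `h ∷ `g ∷ `h ∷ `h ∷ []) ∷
  (`g ∷ `h ∷ `h ∷ `g ∷ `h ∷ `g ∷ `h ∷ `h ∷ `g ∷ `h ∷ []) ∷
  (`h ∷ `g ∷ `h ∷ `h ∷ `g ∷ `h ∷ `g ∷ `h ∷ `h ∷ `g ∷ []) ∷
  (`h ∷ `h ∷ `g ∷ `h ∷ `g ∷ `h ∷ `h ∷ `g ∷ `h ∷ `g ∷ []) ∷
  (`g ∷ `h ∷ `g ∷ `h ∷ `h ∷ `g ∷ `h ∷ `g ∷ `h ∷ `h ∷ `g ∷ []) ∷
  (`g ∷ `h ∷ `h ∷ `g ∷ `h ∷ `g ∷ `h ∷ `h ∷ `g ∷ `h ∷ `g ∷ []) ∷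
  (`h ∷ `g ∷ `h ∷ `h ∷ `g ∷ `h ∷ `g ∷ `h ∷ `h ∷ `g ∷ `h ∷ []) ∷
  (`g ∷ `h ∷ `g ∷ `h ∷ `h ∷ `g ∷ `h ∷ `g ∷ `h ∷ `h ∷ `g ∷ `h ∷ []) ∷ []

Reachable : Table → Set
Reachable f = Any (λ w → f ≗ fwd (wordPerm w)) alternatingWords

reachable? : ∀ f → Dec (Reachable f)
reachable? f = any? (λ w → f ≗? fwd (wordPerm w)) alternatingWords

reachable-resp : ∀ {f h} → f ≗ h → Reachable h → Reachable f
reachable-resp f≗h = Any.map (λ h≗w i → ≡.trans (f≗h i) (h≗w i))

reachable-id : Reachable (fwd idP)
reachable-id = here (λ _ → ≡.refl)

words-closed : ∀ x → All (λ w → Reachable (fwd (wordPerm w ⨾ topOf x))) alternatingWords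
words-closed `g = from-yes (all? (λ w → reachable? (fwd (wordPerm w ⨾ topOf `g))) alternatingWords)
words-closed `h = from-yes (all? (λ w → reachable? (fwd (wordPerm w ⨾ topOf `h))) alternatingWords)

words-inverse : All (λ w → Reachable (bwd (wordPerm w))) alternatingWords
words-inverse = from-yes (all? (λ w → reachable? (bwd (wordPerm w))) alternatingWords)

reachable-⨾-topOf : ∀ {π} x → Reachable (fwd π) → Reachable (fwd (π ⨾ topOf x))
reachable-⨾-topOf {π} x = All.lookupWith {R = λ _ → Reachable (fwd (π ⨾ topOf x))} (λ {w} → step {w}) (words-closed x)
  where
  step : ∀ {w} → Reachable (fwd (wordPerm w ⨾ topOf x)) → fwd π ≗ fwd (wordPerm w) → Reachable (fwd (π ⨾ topOf x))
  step closed π≗w = reachable-resp (λ i → ≡.cong (fwd (topOf x)) (π≗w i)) closed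

reachable-⨾-wordPerm : ∀ {π} w → Reachable (fwd π) → Reachable (fwd (π ⨾ wordPerm w))
reachable-⨾-wordPerm []      r = r
reachable-⨾-wordPerm {π} (x ∷ w) r = reachable-⨾-wordPerm {π ⨾ topOf x} w (reachable-⨾-topOf {π} x r)

reachable-⨾ : ∀ {π σ} → Reachable (fwd π) → Reachable (fwd σ) → Reachable (fwd (π ⨾ σ))
reachable-⨾ {π} {σ} rπ rσ = step (Any.satisfied rσ)
  where
  step : ∃ (λ w → fwd σ ≗ fwd (wordPerm w)) → Reachable (fwd (π ⨾ σ))
  step (w , σ≗w) = reachable-resp (λ i → σ≗w (fwd π i)) (reachable-⨾-wordPerm {π} w rπ)

reachable-inv : ∀ {π} → Reachable (fwd π) → Reachable (fwd (invP π))
reachable-inv {π} = All.lookupWith {R = λ _ → Reachable (bwd π)} (λ {w} → step {w}) words-inverse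
  where
  step : ∀ {w} → Reachable (bwd (wordPerm w)) → fwd π ≗ fwd (wordPerm w) → Reachable (bwd π)
  step {w} inverse π≗w = reachable-resp (bwd-cong π (wordPerm w) π≗w) inverse

inversions-cong : ∀ {f h} → f ≗ h → inversions f ≡ inversions h
inversions-cong f≗h = ≡.cong sum (map-cong (λ i → ≡.cong sum (map-cong (λ j →
  ≡.cong₂ (λ a b → if (toℕ i <ᵇ toℕ j) ∧ (toℕ b <ᵇ toℕ a) then 1 else 0) (f≗h i) (f≗h j)) (allFin 5))) (allFin 5))

words-even : All (λ w → Even (wordPerm w)) alternatingWords
words-even = from-yes (all? (λ w → inversions (fwd (wordPerm w)) % 2 ≟ℕ 0) alternatingWords)

reachable⇒even : ∀ {π} → Reachable (fwd π) → Even π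
reachable⇒even {π} = All.lookupWith {R = λ _ → Even π} (λ {w} → step {w}) words-even
  where
  step : ∀ {w} → Even (wordPerm w) → fwd π ≗ fwd (wordPerm w) → Even π
  step even π≗w = ≡.trans (≡.cong (_% 2) (inversions-cong π≗w)) even

table : Fin 5 → Fin 5 → Fin 5 → Fin 5 → Fin 5 → Table
table a b c d e p1 = a
table a b c d e p2 = b
table a b c d e p3 = c
table a b c d e p4 = d
table a b c d e p5 = e

table-≗ : ∀ f → f ≗ table (f p1) (f p2) (f p3) (f p4) (f p5)
table-≗ f p1 = ≡.refl
table-≗ f p2 = ≡.refl
table-≗ f p3 = ≡.refl
table-≗ f p4 = ≡.refl
table-≗ f p5 = ≡.refl

Injective : Table → Set
Injective f = ∀ i j → f i ≡ f j → i ≡ j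

-- Exhaustive search over all 5⁵ tables.
even-tables-reachable : ∀ a b c d e → Injective (table a b c d e) →
                        inversions (table a b c d e) % 2 ≡ 0 → Reachable (table a b c d e)
even-tables-reachable = from-yes
  (∀-fin? λ a → ∀-fin? λ b → ∀-fin? λ c → ∀-fin? λ d → ∀-fin? λ e →
     injective? (table a b c d e) →-dec (inversions (table a b c d e) % 2 ≟ℕ 0 →-dec reachable? (table a b c d e)))
  where
  injective? : ∀ f → Dec (Injective f)
  injective? f = ∀-fin? λ i → ∀-fin? λ j → f i ≟ᶠ f j →-dec i ≟ᶠ j

even⇒reachable : ∀ π → Even π → Reachable (fwd π)
even⇒reachable π even = reachable-resp (table-≗ f)
  (even-tables-reachable (f p1) (f p2) (f p3) (f p4) (f p5)
    (λ i j eq → injective i j (≡.trans (table-≗ f i) (≡.trans eq (≡.sym (table-≗ f j)))))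
    (≡.trans (≡.cong (_% 2) (≡.sym (inversions-cong (table-≗ f)))) even))
  where
  f = fwd π
  injective : Injective f
  injective i j eq = ≡.trans (≡.sym (left π i)) (≡.trans (≡.cong (bwd π) eq) (left π j))

module WreathGroup {c ℓ : Level} (P : Group c ℓ) where
  open Wreath P

  private
    entry-cong : ∀ {i j : Fin 5} (t : Fin 5 → P.Carrier) → i ≡ j → t i P.≈ t j
    entry-cong t eq = P.reflexive (≡.cong t eq)

  wreath : Group c ℓ
  wreath = record
    { Carrier = W ; _≈_ = _≈W_ ; _∙_ = _∙W_ ; ε = εW ; _⁻¹ = _⁻¹W
    ; isGroup = record
      { isMonoid = record
        { isSemigroup = record
          { isMagma = record
            { isEquivalence = record
              { refl  = (λ _ → P.refl) , (λ _ → ≡.refl)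
              ; sym   = λ (p , q) → (λ i → P.sym (p i)) , (λ i → ≡.sym (q i))
              ; trans = λ (p , q) (p′ , q′) → (λ i → P.trans (p i) (p′ i)) , (λ i → ≡.trans (q i) (q′ i)) }
            ; ∙-cong = λ { {t ▹ π} {t′ ▹ π′} {s ▹ σ} {s′ ▹ σ′} (p , q) (p′ , q′) →
                 (λ i → P.∙-cong (p i) (P.trans (p′ (fwd π i)) (entry-cong s′ (q i))))
               , (λ i → ≡.trans (q′ (fwd π i)) (≡.cong (fwd σ′) (q i))) } }
          ; assoc = λ _ _ _ → (λ i → P.assoc _ _ _) , (λ i → ≡.refl) }
        ; identity = (λ _ → (λ i → P.identityˡ _) , (λ i → ≡.refl))
                   , (λ _ → (λ i → P.identityʳ _) , (λ i → ≡.refl)) }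
      ; inverse = (λ (t ▹ π) → (λ i → P.inverseˡ _) , right π)
                , (λ (t ▹ π) → (λ i → P.trans (P.∙-congˡ (P.⁻¹-cong (entry-cong t (left π i)))) (P.inverseʳ _)) , left π)
      ; ⁻¹-cong = λ { {t ▹ π} {s ▹ σ} (p , q) →
           (λ j → P.⁻¹-cong (P.trans (p (bwd π j)) (entry-cong s (bwd-cong π σ q j))))
         , bwd-cong π σ q } } }

  open Group P using (_≈_; _∙_; ε; _⁻¹)
  open GroupWords P using (solve; x₀; ε′; _∙′_)
  module 𝒫 = Subgroups P
  module 𝒲 = Subgroups wreath
  open 𝒲 using (IsSubgroup)
  open GroupProperties P using (ε⁻¹≈ε)

  select : Bool → P.Carrier → P.Carrier
  select b a = if b then a else ε

  point : Fin 5 → P.Carrier → Fin 5 → P.Carrier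
  point j a i = select (does (i ≟ᶠ j)) a

  pick : Fin 5 → P.Carrier → W
  pick j a = point j a ▹ idP

  -- The base group is the product of the five coordinate subgroups.
  base-⊆ : ∀ {k} {S : W → Set k} → IsSubgroup S → (∀ j a → S (pick j a)) → ∀ u → S (u ▹ idP)
  base-⊆ {S = S} S-sub S∋pick u =
    ∈-resp-≈ (product≈u , λ _ → ≡.refl)
      (∙-closed (∙-closed (∙-closed (∙-closed (S∋pick p1 (u p1)) (S∋pick p2 (u p2))) (S∋pick p3 (u p3)))
                          (S∋pick p4 (u p4)))
                (S∋pick p5 (u p5)))
    where
    open IsSubgroup S-sub
    product≈u : ∀ i → (((point p1 (u p1) i ∙ point p2 (u p2) i) ∙ point p3 (u p3) i) ∙ point p4 (u p4) i)
                      ∙ point p5 (u p5) i ≈ u i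
    product≈u p1 = solve (u p1 ∷ᵛ []ᵛ) ((((x₀ ∙′ ε′) ∙′ ε′) ∙′ ε′) ∙′ ε′) x₀ ≡.refl
    product≈u p2 = solve (u p2 ∷ᵛ []ᵛ) ((((ε′ ∙′ x₀) ∙′ ε′) ∙′ ε′) ∙′ ε′) x₀ ≡.refl
    product≈u p3 = solve (u p3 ∷ᵛ []ᵛ) ((((ε′ ∙′ ε′) ∙′ x₀) ∙′ ε′) ∙′ ε′) x₀ ≡.refl
    product≈u p4 = solve (u p4 ∷ᵛ []ᵛ) ((((ε′ ∙′ ε′) ∙′ ε′) ∙′ x₀) ∙′ ε′) x₀ ≡.refl
    product≈u p5 = solve (u p5 ∷ᵛ []ᵛ) ((((ε′ ∙′ ε′) ∙′ ε′) ∙′ ε′) ∙′ x₀) x₀ ≡.refl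

  pick-preimage-isSubgroup : ∀ j {k} {S : W → Set k} → IsSubgroup S → 𝒫.IsSubgroup (λ a → S (pick j a))
  pick-preimage-isSubgroup j S-sub = record
    { ε∈        = ∈-resp-≈ ((λ i → P.sym (select-ε (does (i ≟ᶠ j)))) , λ _ → ≡.refl) ε∈
    ; ∙-closed  = λ {a} {b} → λ p q →
        ∈-resp-≈ ((λ i → P.sym (select-∙ (does (i ≟ᶠ j)) a b)) , λ _ → ≡.refl) (∙-closed p q)
    ; ⁻¹-closed = λ {a} p → ∈-resp-≈ ((λ i → P.sym (select-⁻¹ (does (i ≟ᶠ j)) a)) , λ _ → ≡.refl) (⁻¹-closed p)
    ; ∈-resp-≈  = λ a≈b → ∈-resp-≈ ((λ i → select-cong (does (i ≟ᶠ j)) a≈b) , λ _ → ≡.refl)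
    }
    where
    open IsSubgroup S-sub
    select-ε : ∀ b → select b ε ≈ ε
    select-ε true  = P.refl
    select-ε false = P.refl
    select-∙ : ∀ b x y → select b (x ∙ y) ≈ select b x ∙ select b y
    select-∙ true  x y = P.refl
    select-∙ false x y = P.sym (P.identityʳ ε)
    select-⁻¹ : ∀ b x → select b (x ⁻¹) ≈ select b x ⁻¹
    select-⁻¹ true  x = P.refl
    select-⁻¹ false x = P.sym ε⁻¹≈ε
    select-cong : ∀ b {x y} → x ≈ y → select b x ≈ select b y
    select-cong true  x≈y = x≈y
    select-cong false x≈y = P.refl

  pick-[,] : ∀ j a b → pick j 𝒫.[ a , b ] ≈W 𝒲.[ pick j a , pick j b ]
  pick-[,] j a b = (λ i → select-[,] (does (i ≟ᶠ j))) , λ _ → ≡.refl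
    where
    select-[,] : ∀ s → select s 𝒫.[ a , b ] ≈ 𝒫.[ select s a , select s b ]
    select-[,] true  = P.refl
    select-[,] false = P.sym (𝒫.[,]-self ε)

  conjugate-base : ∀ t π b → ((b ▹ idP) 𝒲.^ (t ▹ π)) ≈W ((λ i → b (bwd π i) 𝒫.^ t (bwd π i)) ▹ idP)
  conjugate-base t π b = (λ _ → P.refl) , right π

  base-[,] : ∀ u w → 𝒲.[ u ▹ idP , w ▹ idP ] ≈W ((λ i → 𝒫.[ u i , w i ]) ▹ idP)
  base-[,] u w = (λ _ → P.refl) , λ _ → ≡.refl

-- ⟨ g , h₁ ⟩ = X

genBase : Gen → Fin 5 → List Letter
genBase `g p2 = `μ ∷ []
genBase `g p5 = `μ ∷ []
genBase `g _  = []
genBase `h p4 = `λ ∷ []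
genBase `h p5 = `λ⁻¹ ∷ []
genBase `h _  = []

wordBase : List Gen → Fin 5 → List Letter
wordBase []      i = []
wordBase (x ∷ w) i = genBase x i ++ wordBase w (fwd (topOf x) i)

module Generation {c ℓ : Level} (P : Group c ℓ) (μ la : Group.Carrier P)
  (perfect : Subgroups.IsPerfect P) (generates : ∀ x → Subgroups.⟨_⟩ P (μ ∷ la ∷ []) x)
  (μ²≈ε : Group._≈_ P (Group._∙_ P μ μ) (Group.ε P))
  (λ³≈ε : Group._≈_ P (Group._∙_ P (Group._∙_ P la la) la) (Group.ε P)) where

  open Wreath P
  open Elements μ la
  open WreathGroup P
  open Group P using (_≈_; _∙_; ε; _⁻¹)
  open GroupWords P using (solve; x₀; x₁; ε′; _∙′_; _⁻¹′)
  open TwoThreeWords P μ la using (⟦_⟧; ++-homo; reduce-sound)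
  module 𝕎 = Group wreath

  𝔾 : W → Set (c ⊔ ℓ)
  𝔾 = 𝒲.⟨ g ∷ h₁ ∷ [] ⟩

  genElement : Gen → W
  genElement `g = g
  genElement `h = h₁

  genElement-∈ : ∀ x → 𝔾 (genElement x)
  genElement-∈ `g = 𝒲.gen (here (𝕎.refl {g}))
  genElement-∈ `h = 𝒲.gen (there (here (𝕎.refl {h₁})))

  -- The element of ⟨ g , h₁ ⟩ spelled by a word, with its coordinates kept as words in μ, λ
  -- so that they can be normalised by computation.
  element : List Gen → W
  element w = (λ i → ⟦ wordBase w i ⟧) ▹ wordPerm w

  element-∈ : ∀ w → 𝔾 (element w)
  element-∈ []      = 𝒲.unit
  element-∈ (x ∷ w) = 𝒲.resp {x = genElement x ∙W element w} (element-∷ x) (𝒲.mul (genElement-∈ x) (element-∈ w))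
    where
    genBase-≈ : ∀ x i → ⟦ genBase x i ⟧ ≈ base (genElement x) i
    genBase-≈ `g p1 = P.refl
    genBase-≈ `g p2 = P.identityʳ μ
    genBase-≈ `g p3 = P.refl
    genBase-≈ `g p4 = P.refl
    genBase-≈ `g p5 = P.identityʳ μ
    genBase-≈ `h p1 = P.refl
    genBase-≈ `h p2 = P.refl
    genBase-≈ `h p3 = P.refl
    genBase-≈ `h p4 = P.identityʳ la
    genBase-≈ `h p5 = P.identityʳ (la ⁻¹)
    element-∷ : ∀ x → (genElement x ∙W element w) ≈W element (x ∷ w)
    element-∷ `g = (λ i → P.sym (P.trans (++-homo (genBase `g i) _) (P.∙-congʳ (genBase-≈ `g i)))) , λ _ → ≡.refl
    element-∷ `h = (λ i → P.sym (P.trans (++-homo (genBase `h i) _) (P.∙-congʳ (genBase-≈ `h i)))) , λ _ → ≡.refl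

  element-base : ∀ w i → base (element w) i ≈ ⟦ reduce (wordBase w i) ⟧
  element-base w i = P.sym (reduce-sound μ²≈ε λ³≈ε (wordBase w i))

  Stabilised : P.Carrier → Set (c ⊔ ℓ)
  Stabilised a = Σ W λ y → 𝔾 y × fwd (top y) p1 ≡ p1 × fwd (top y) p2 ≡ p2 × base y p1 ≈ a

  stabilised-isSubgroup : 𝒫.IsSubgroup Stabilised
  stabilised-isSubgroup = record
    { ε∈        = εW , 𝒲.unit , ≡.refl , ≡.refl , P.refl
    ; ∙-closed  = λ { (t ▹ π , t∈ , π₁ , π₂ , t₁≈a) (s ▹ σ , s∈ , σ₁ , σ₂ , s₁≈b) →
          (t ▹ π) ∙W (s ▹ σ) , 𝒲.mul t∈ s∈
        , ≡.trans (≡.cong (fwd σ) π₁) σ₁ , ≡.trans (≡.cong (fwd σ) π₂) σ₂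
        , P.∙-cong t₁≈a (P.trans (P.reflexive (≡.cong s π₁)) s₁≈b) }
    ; ⁻¹-closed = λ { (t ▹ π , t∈ , π₁ , π₂ , t₁≈a) →
          (t ▹ π) ⁻¹W , 𝒲.inv t∈ , fix⇒bwd π π₁ , fix⇒bwd π π₂
        , P.⁻¹-cong (P.trans (P.reflexive (≡.cong t (fix⇒bwd π π₁))) t₁≈a) }
    ; ∈-resp-≈  = λ { a≈b (y , y∈ , π₁ , π₂ , y₁≈a) → y , y∈ , π₁ , π₂ , P.trans y₁≈a a≈b }
    }

  stabilised-everything : ∀ a → Stabilised a
  stabilised-everything a = 𝒫.closure-least stabilised-isSubgroup generator
    (TwoGeneratedPerfect.λ-and-μλμ-generate P μ la perfect generates μ²≈ε a)
    where
    open 𝒫.IsSubgroup stabilised-isSubgroup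
    generator : ∀ {x} → Any (x ≈_) (la ∷ TwoGeneratedPerfect.μλμ P μ la ∷ []) → Stabilised x
    generator (here x≈λ) = ∈-resp-≈ (P.sym x≈λ)
      ( element (`g ∷ `h ∷ `g ∷ []) , element-∈ (`g ∷ `h ∷ `g ∷ []) , ≡.refl , ≡.refl
      , P.trans (element-base (`g ∷ `h ∷ `g ∷ []) p1) (P.identityʳ la))
    generator (there (here x≈μλμ)) = ∈-resp-≈ (P.sym x≈μλμ)
      ( element μλμ-word , element-∈ μλμ-word , ≡.refl , ≡.refl
      , P.trans (element-base μλμ-word p1) (solve (μ ∷ᵛ la ∷ᵛ []ᵛ) (x₀ ∙′ (x₁ ∙′ (x₀ ∙′ ε′))) ((x₀ ∙′ x₁) ∙′ x₀) ≡.refl))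
      where
      μλμ-word : List Gen
      μλμ-word = `h ∷ `h ∷ `g ∷ `h ∷ `h ∷ `g ∷ `h ∷ `h ∷ `g ∷ `h ∷ `h ∷ []

  Realised : Fin 5 → (Fin 5 → Set) → P.Carrier → Set (c ⊔ ℓ)
  Realised k J a = Σ (Fin 5 → P.Carrier) λ b → 𝔾 (b ▹ idP) × b k ≈ a × (∀ i → J i → b i ≈ ε)

  realised-isSubgroup : ∀ k J → 𝒫.IsSubgroup (Realised k J)
  realised-isSubgroup k J = record
    { ε∈        = (λ _ → ε) , 𝒲.unit , P.refl , (λ _ _ → P.refl)
    ; ∙-closed  = λ (b , b∈ , bₖ≈x , b-J) (d , d∈ , dₖ≈y , d-J) →
          (λ i → b i ∙ d i) , 𝒲.mul b∈ d∈ , P.∙-cong bₖ≈x dₖ≈y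
        , (λ i Ji → P.trans (P.∙-cong (b-J i Ji) (d-J i Ji)) (P.identityʳ ε))
    ; ⁻¹-closed = λ (b , b∈ , bₖ≈x , b-J) →
          (λ i → b i ⁻¹) , 𝒲.inv b∈ , P.⁻¹-cong bₖ≈x , (λ i Ji → P.trans (P.⁻¹-cong (b-J i Ji)) ε⁻¹≈ε)
    ; ∈-resp-≈  = λ x≈y (b , b∈ , bₖ≈x , b-J) → b , b∈ , P.trans bₖ≈x x≈y , b-J
    }
    where open GroupProperties P using (ε⁻¹≈ε)

  realised-mono : ∀ {k J J′ a} → (∀ i → J′ i → J i) → Realised k J a → Realised k J′ a
  realised-mono J′⊆J (b , b∈ , bₖ≈a , b-J) = b , b∈ , bₖ≈a , λ i J′i → b-J i (J′⊆J i J′i)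

  realised-^ : ∀ {t π k k′ J a} → 𝔾 (t ▹ π) → fwd π k ≡ k′ → Realised k J a →
               Realised k′ (λ i → J (bwd π i)) (a 𝒫.^ t k)
  realised-^ {t} {π} {k} {k′} t∈ πk≡k′ (b , b∈ , bₖ≈a , b-J) =
      (λ i → b (bwd π i) 𝒫.^ t (bwd π i))
    , 𝒲.resp {x = (b ▹ idP) 𝒲.^ (t ▹ π)} (conjugate-base t π b) (𝒲.mul (𝒲.mul (𝒲.inv t∈) b∈) t∈)
    , P.trans (P.reflexive (≡.cong (λ j → b j 𝒫.^ t j) π⁻¹k′≡k)) (𝒫.^-cong bₖ≈a P.refl)
    , λ i Ji → P.trans (𝒫.^-cong (b-J (bwd π i) Ji) P.refl) (𝒫.ε^ (t (bwd π i)))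
    where
    π⁻¹k′≡k : bwd π k′ ≡ k
    π⁻¹k′≡k = ≡.trans (≡.cong (bwd π) (≡.sym πk≡k′)) (left π k)

  realised-transport : ∀ w {k k′ J} → fwd (wordPerm w) k ≡ k′ → (∀ a → Realised k J a) →
                       ∀ a → Realised k′ (λ i → J (bwd (wordPerm w) i)) a
  realised-transport w {k} πk≡k′ realised a =
    𝒫.IsSubgroup.∈-resp-≈ (realised-isSubgroup _ _)
      (solve (t ∷ᵛ a ∷ᵛ []ᵛ) ((x₀ ⁻¹′ ∙′ ((x₀ ∙′ x₁) ∙′ x₀ ⁻¹′)) ∙′ x₀) x₁ ≡.refl)
      (realised-^ (element-∈ w) πk≡k′ (realised ((t ∙ a) ∙ t ⁻¹)))
    where
    t : P.Carrier
    t = base (element w) k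

  N : P.Carrier → Set (c ⊔ ℓ)
  N = Realised p1 (_≡ p2)

  N-isSubgroup : 𝒫.IsSubgroup N
  N-isSubgroup = realised-isSubgroup p1 (_≡ p2)

  -- Conjugating by an element of ⟨ g , h₁ ⟩ fixing 1 and 2 with first coordinate x.
  N-normal : 𝒫.IsNormal N
  N-normal x Na = conjugate (stabilised-everything x)
    where
    conjugate : Stabilised x → N _
    conjugate (t ▹ π , y∈ , π₁ , π₂ , t₁≈x) =
      𝒫.IsSubgroup.∈-resp-≈ N-isSubgroup (𝒫.^-cong P.refl t₁≈x)
        (realised-mono (λ { i ≡.refl → fix⇒bwd π π₂ }) (realised-^ y∈ π₁ Na))

  N∋relator : N ⟦ λμ-power 6 ⟧
  N∋relator = base (element seed) , 𝒲.resp {x = element seed} ((λ _ → P.refl) , top-trivial) (element-∈ seed)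
            , element-base seed p1 , λ { i ≡.refl → element-base seed p2 }
    where
    seed : List Gen
    seed = `g ∷ `h ∷ `g ∷ `h ∷ `g ∷ `h ∷ `h ∷ `g ∷ `h ∷ `h ∷ `g ∷ `h ∷ `g ∷ `h ∷ `g ∷
           `h ∷ `h ∷ `g ∷ `h ∷ `h ∷ `g ∷ `h ∷ `g ∷ `h ∷ `g ∷ `h ∷ `h ∷ `g ∷ `h ∷ `h ∷ []
    top-trivial : ∀ i → fwd (wordPerm seed) i ≡ i
    top-trivial p1 = ≡.refl
    top-trivial p2 = ≡.refl
    top-trivial p3 = ≡.refl
    top-trivial p4 = ≡.refl
    top-trivial p5 = ≡.refl

  -- P/N satisfies the relations of Δ(2,3,6).
  N-everything : ∀ a → N a
  N-everything a = ≈ₙε⇒∈ (TwoGeneratedPerfect.Δ236-perfect-quotient-trivial quotient μ la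
    (quotient-isPerfect N-isSubgroup N-normal perfect)
    (λ x → ⟨⟩-quotient N-isSubgroup N-normal (generates x))
    (≈⇒≈ₙ μ²≈ε) (≈⇒≈ₙ λ³≈ε) (∈⇒≈ₙε N∋relator) a)
    where
    open 𝒫.Quotient N N-isSubgroup N-normal
    open AbelianQuotient P using (quotient-isPerfect; ⟨⟩-quotient)

  realised-∪ : ∀ {k J J′} → (∀ a → Realised k J a) → (∀ a → Realised k J′ a) → ∀ a → Realised k (J ∪ J′) a
  realised-∪ {k} {J} {J′} realised realised′ =
    𝒫.perfect-⊆ perfect (realised-isSubgroup k (J ∪ J′)) (λ a b → commutator (realised a) (realised′ b))
    where
    commutator : ∀ {a b} → Realised k J a → Realised k J′ b → Realised k (J ∪ J′) 𝒫.[ a , b ]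
    commutator (u , u∈ , uₖ≈a , u-J) (w , w∈ , wₖ≈b , w-J′) =
        (λ i → 𝒫.[ u i , w i ])
      , 𝒲.resp {x = 𝒲.[ u ▹ idP , w ▹ idP ]} (base-[,] u w) (𝒲.mul (𝒲.mul (𝒲.inv u∈) (𝒲.inv w∈)) (𝒲.mul u∈ w∈))
      , 𝒫.[,]-cong uₖ≈a wₖ≈b
      , λ { i (inj₁ Ji) → 𝒫.[,]-trivialˡ (u-J i Ji) ; i (inj₂ J′i) → 𝒫.[,]-trivialʳ (w-J′ i J′i) }

  -- Words fixing 1 and sending 2 to 3, 4 and 5 turn N into the analogous subgroups for those points.
  realised₁-everything : ∀ a → Realised p1 (λ i → ¬ i ≡ p1) a
  realised₁-everything a = realised-mono others
    (realised-∪ (realised-∪ (realised-∪ N-everything (vanishing-at (`h ∷ `g ∷ `h ∷ `h ∷ `g ∷ `h ∷ `g ∷ `h ∷ []) ≡.refl))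
                            (vanishing-at (`h ∷ `h ∷ `g ∷ `h ∷ []) ≡.refl))
                (vanishing-at (`h ∷ `g ∷ `h ∷ `h ∷ `g ∷ `h ∷ `h ∷ []) ≡.refl) a)
    where
    vanishing-at : ∀ w → fwd (wordPerm w) p1 ≡ p1 → ∀ a → Realised p1 (_≡ fwd (wordPerm w) p2) a
    vanishing-at w fixes₁ a =
      realised-mono (λ { i ≡.refl → left (wordPerm w) p2 }) (realised-transport w fixes₁ N-everything a)
    others : ∀ i → ¬ i ≡ p1 → ((i ≡ p2 ⊎ i ≡ p3) ⊎ i ≡ p4) ⊎ i ≡ p5
    others p1 i≢p1 = ⊥-elim (i≢p1 ≡.refl)
    others p2 _ = inj₁ (inj₁ (inj₁ ≡.refl))
    others p3 _ = inj₁ (inj₁ (inj₂ ≡.refl))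
    others p4 _ = inj₁ (inj₂ ≡.refl)
    others p5 _ = inj₂ ≡.refl

  private
    moved-to : ∀ w {j} → fwd (wordPerm w) p1 ≡ j → ∀ a → Realised j (λ i → ¬ i ≡ j) a
    moved-to w {j} π₁≡j a = realised-mono avoids (realised-transport w π₁≡j realised₁-everything a)
      where
      avoids : ∀ i → ¬ i ≡ j → ¬ bwd (wordPerm w) i ≡ p1
      avoids i i≢j π⁻¹i≡1 = i≢j (≡.trans (≡.sym (right (wordPerm w) i)) (≡.trans (≡.cong (fwd (wordPerm w)) π⁻¹i≡1) π₁≡j))

  -- Words sending 1 to j move the first coordinate to the j-th.
  single : ∀ j a → Realised j (λ i → ¬ i ≡ j) a
  single p1 = realised₁-everything
  single p2 = moved-to (`h ∷ []) ≡.refl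
  single p3 = moved-to (`h ∷ `h ∷ []) ≡.refl
  single p4 = moved-to (`g ∷ []) ≡.refl
  single p5 = moved-to (`h ∷ `g ∷ []) ≡.refl

  pick-∈ : ∀ j a → 𝔾 (pick j a)
  pick-∈ j a = agree (single j a)
    where
    agree : Realised j (λ i → ¬ i ≡ j) a → 𝔾 (pick j a)
    agree (b , b∈ , bⱼ≈a , b-J) = 𝒲.resp {x = b ▹ idP} ((λ i → coordinate i) , λ _ → ≡.refl) b∈
      where
      coordinate : ∀ i → b i ≈ point j a i
      coordinate i with i ≟ᶠ j
      ... | yes ≡.refl = bⱼ≈a
      ... | no i≢j     = b-J i i≢j

  base-∈ : ∀ u → 𝔾 (u ▹ idP)
  base-∈ = base-⊆ (𝒲.closure-isSubgroup _) pick-∈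

  X⊆𝔾 : ∀ x → InX x → 𝔾 x
  X⊆𝔾 (t ▹ π) π-even = split (Any.satisfied (even⇒reachable π π-even))
    where
    split : ∃ (λ w → fwd π ≗ fwd (wordPerm w)) → 𝔾 (t ▹ π)
    split (w , π≗w) = 𝒲.resp {x = ((λ i → t i ∙ e i ⁻¹) ▹ idP) ∙W element w}
      ((λ i → solve (t i ∷ᵛ e i ∷ᵛ []ᵛ) ((x₀ ∙′ x₁ ⁻¹′) ∙′ x₁) x₀ ≡.refl) , λ i → ≡.sym (π≗w i))
      (𝒲.mul (base-∈ _) (element-∈ w))
      where
      e : Fin 5 → P.Carrier
      e = base (element w)

  𝔾⊆X : ∀ x → 𝔾 x → InX x
  𝔾⊆X x x∈ = reachable⇒even {top x} (𝒲.closure-least reachable-isSubgroup (λ {y} → generator {y}) x∈)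
    where
    reachable-isSubgroup : 𝒲.IsSubgroup (λ y → Reachable (fwd (top y)))
    reachable-isSubgroup = record
      { ε∈        = reachable-id
      ; ∙-closed  = λ {y} {z} → reachable-⨾ {top y} {top z}
      ; ⁻¹-closed = λ {y} → reachable-inv {top y}
      ; ∈-resp-≈  = λ y≈z → reachable-resp (λ i → ≡.sym (proj₂ y≈z i))
      }
    generator : ∀ {y} → Any (y ≈W_) (g ∷ h₁ ∷ []) → Reachable (fwd (top y))
    generator (here y≈g)          = reachable-resp (proj₂ y≈g) (even⇒reachable perm14-25 ≡.refl)
    generator (there (here y≈h₁)) = reachable-resp (proj₂ y≈h₁) (even⇒reachable cyc123 ≡.refl)

  X′ : W → Set (c ⊔ ℓ)
  X′ = 𝒲.Closure (𝒲.Commutator InX)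

  topOnly : Perm5 → W
  topOnly π = (λ _ → ε) ▹ π

  topOnly-∈X′ : ∀ α β {γ} → Even α → Even β → fwd γ ≗ fwd (((invP α ⨾ invP β) ⨾ α) ⨾ β) → X′ (topOnly γ)
  topOnly-∈X′ α β α-even β-even γ≗[α,β] =
    𝒲.gen (topOnly α , topOnly β , α-even , β-even , (λ _ → P.sym (𝒫.[,]-self ε)) , γ≗[α,β])

  ∈X′-from-top : ∀ t π → X′ (topOnly π) → X′ (t ▹ π)
  ∈X′-from-top t π top∈X′ = 𝒲.resp {x = (t ▹ idP) ∙W topOnly π} ((λ i → P.identityʳ (t i)) , λ _ → ≡.refl)
    (𝒲.mul (base-⊆ (𝒲.closure-isSubgroup _) pick-∈X′ t) top∈X′)
    where
    pick-∈X′ : ∀ j a → X′ (pick j a)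
    pick-∈X′ j = 𝒫.perfect-⊆ perfect (pick-preimage-isSubgroup j (𝒲.closure-isSubgroup _))
      (λ a b → 𝒲.gen (pick j a , pick j b , ≡.refl , ≡.refl , pick-[,] j a b))

  X-perfect : GroupNotions.Perfect Wr InX
  X-perfect x x∈X = 𝒲.closure-least (𝒲.closure-isSubgroup _) generator (X⊆𝔾 x x∈X)
    where
    g∈X′ : X′ g
    g∈X′ = ∈X′-from-top (base g) perm14-25
      (topOnly-∈X′ (wordPerm (`h ∷ `g ∷ `h ∷ `g ∷ `h ∷ `h ∷ [])) (wordPerm (`g ∷ `h ∷ `g ∷ `h ∷ `g ∷ `h ∷ `h ∷ []))
                  ≡.refl ≡.refl (≗-by-cases ≡.refl ≡.refl ≡.refl ≡.refl ≡.refl))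
    h₁∈X′ : X′ h₁
    h₁∈X′ = ∈X′-from-top (base h₁) cyc123
      (topOnly-∈X′ (wordPerm (`h ∷ [])) (wordPerm (`g ∷ `h ∷ `g ∷ `h ∷ `h ∷ `g ∷ `h ∷ `g ∷ `h ∷ `h ∷ `g ∷ []))
                  ≡.refl ≡.refl (≗-by-cases ≡.refl ≡.refl ≡.refl ≡.refl ≡.refl))
    generator : ∀ {y} → Any (y ≈W_) (g ∷ h₁ ∷ []) → X′ y
    generator {y} (here y≈g)          = 𝒲.resp (𝕎.sym {y} {g} y≈g) g∈X′
    generator {y} (there (here y≈h₁)) = 𝒲.resp (𝕎.sym {y} {h₁} y≈h₁) h₁∈X′

  X-generated : GroupNotions.GeneratedBy Wr InX (g ∷ h₁ ∷ [])
  X-generated = X⊆𝔾 , 𝔾⊆X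

  g-order2 : GroupNotions.Order2 Wr g
  g-order2 = (λ g≈ε → p4≢p1 (proj₂ g≈ε p1))
           , (λ { p1 → P.identityʳ ε ; p2 → μ²≈ε ; p3 → P.identityʳ ε ; p4 → P.identityʳ ε ; p5 → μ²≈ε })
           , ≗-by-cases ≡.refl ≡.refl ≡.refl ≡.refl ≡.refl
    where
    p4≢p1 : ¬ p4 ≡ p1
    p4≢p1 ()

  h₁-order3 : GroupNotions.Order3 Wr h₁
  h₁-order3 = (λ h₁≈ε → p2≢p1 (proj₂ h₁≈ε p1))
            , (λ { p1 → εεε≈ε ; p2 → εεε≈ε ; p3 → εεε≈ε ; p4 → λ³≈ε ; p5 → λ⁻³≈ε })
            , ≗-by-cases ≡.refl ≡.refl ≡.refl ≡.refl ≡.refl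
    where
    open GroupProperties P using (ε⁻¹≈ε)
    p2≢p1 : ¬ p2 ≡ p1
    p2≢p1 ()
    εεε≈ε : (ε ∙ ε) ∙ ε ≈ ε
    εεε≈ε = solve []ᵛ ((ε′ ∙′ ε′) ∙′ ε′) ε′ ≡.refl
    λ⁻³≈ε : (la ⁻¹ ∙ la ⁻¹) ∙ la ⁻¹ ≈ ε
    λ⁻³≈ε = P.trans (solve (la ∷ᵛ []ᵛ) ((x₀ ⁻¹′ ∙′ x₀ ⁻¹′) ∙′ x₀ ⁻¹′) (((x₀ ∙′ x₀) ∙′ x₀) ⁻¹′) ≡.refl)
                    (P.trans (P.⁻¹-cong λ³≈ε) ε⁻¹≈ε)

mainTheorem6 : ∀ {c ℓ} (P : Group c ℓ) (μ la : Group.Carrier P)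
    → Finite P
    → GroupNotions.Perfect (Group.rawGroup P) (λ _ → ⊤)
    → (∀ x → GroupNotions.⟨_⟩ (Group.rawGroup P) (μ ∷ la ∷ []) x)
    → GroupNotions.Order2 (Group.rawGroup P) μ
    → GroupNotions.Order3 (Group.rawGroup P) la
    → let open Wreath P
          open Elements μ la
          open GroupNotions Wr
          H = ⟨ h₁ ∷ h₂ ∷ [] ⟩
      in CosetGraph.Connected H g InX
         × GeneratedBy InX (g ∷ h₁ ∷ [])
         × Perfect InX
         × TwoThreeGenerated InX
mainTheorem6 P μ la _ perfect generates (_ , μ²≈ε) (_ , λ³≈ε) =
    connected (proj₂ g-order2) h₁∈H X⊆𝔾
  , X-generated
  , X-perfect
  , (g , h₁ , ≡.refl , ≡.refl , g-order2 , h₁-order3 , X-generated)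
  where
  open Wreath P
  open Elements μ la
  open Generation P μ la perfect generates μ²≈ε λ³≈ε
  open Subgroups (WreathGroup.wreath P) using (⟨_⟩; closure-isSubgroup; gen)
  open CosetGraphWalks (WreathGroup.wreath P) (closure-isSubgroup _) g using (connected)
  h₁∈H : ⟨ h₁ ∷ h₂ ∷ [] ⟩ h₁
  h₁∈H = gen (here (Group.refl (WreathGroup.wreath P) {h₁}))
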